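{- Let $n\geq 4$ and let $G$ be a finite connected simple graph with exactly $n$ edges and with nonempty boundary $B(G)$. Then $$\lambda_{1,1}(G)\geq \frac{1}{n-1},$$ with equality if and only if $G$ is isomorphic to $T_{n,i}$ for some $i$ with $3\leq i<n$.
   Context: For a finite connected graph $G$, the boundary is $B(G)=\{x\in V(G): \deg(x)=1\}$ (pendant vertices) and the interior is $\Omega(G)=V(G)\setminus B(G)$. The first $1$-Dirichlet eigenvalue is $\lambda_{1,1}(G)=\min\{\sum_{\{x,y\}\in E(G)}|f(x)-f(y)|/\sum_{x\in V(G)}|f(x)| : f\in\mathbb{R}^{V(G)}\setminus\{0\},\ f|_{B(G)}\equiv 0\}$; it is known to equal the Dirichlet Cheeger constant $h_D(G)=\min_{\emptyset\neq U\subset\Omega(G)}|E(U,U^c)|/|U|$, where $E(U,U^c)$ is the set of edges with one endpoint in $U$ and the other outside $U$. For $n>i\geq 3$, the tadpole graph $T_{n,i}$ is the graph with vertices $t_1,\dots,t_n$ and edges $\{t_k,t_{k+1}\}$ for $1\le k\le n-1$ together with $\{t_1,t_i\}$ (a cycle of length $i$ with a path attached at $t_i$); it has $n$ edges.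
   Formalization: The test functions f in the minimum defining $\lambda_{1,1}(G)$ take values in ℚ instead of ℝ. -}

module Defs where

open import Data.Nat as ℕ using (ℕ; zero; suc; _∸_; _≡ᵇ_)
open import Data.Bool using (Bool; true; false; _∧_; _∨_; if_then_else_; T)
open import Data.Fin using (Fin; toℕ; _<?_)
open import Data.Integer using (+_)
open import Data.Rational as ℚ using (ℚ; 0ℚ; _+_; _-_; _*_; ∣_∣; _/_; _≤_)
open import Data.Product using (Σ; ∃; _×_; _,_)
open import Relation.Binary.PropositionalEquality using (_≡_; _≢_)
open import Relation.Nullary using (¬_)
open import Relation.Nullary.Decidable using (⌊_⌋)
open import Function.Bundles using (_↔_; Inverse)

record Graph : Set where
  field
    V    : ℕ
    adj  : Fin V → Fin V → Bool
    sym  : ∀ x y → adj x y ≡ adj y x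
    irr  : ∀ x → adj x x ≡ false
open Graph public

sumℕ : ∀ {k} → (Fin k → ℕ) → ℕ
sumℕ {zero}  f = 0
sumℕ {suc k} f = f Fin.zero ℕ.+ sumℕ (λ i → f (Fin.suc i))
  where import Data.Fin as Fin

sumℚ : ∀ {k} → (Fin k → ℚ) → ℚ
sumℚ {zero}  f = 0ℚ
sumℚ {suc k} f = f Fin.zero + sumℚ (λ i → f (Fin.suc i))
  where import Data.Fin as Fin

ind : Bool → ℕ
ind true  = 1
ind false = 0

deg : (G : Graph) → Fin (V G) → ℕ
deg G x = sumℕ (λ y → ind (adj G x y))

edgeCount : Graph → ℕ
edgeCount G = sumℕ (λ x → sumℕ (λ y → ind (⌊ x <? y ⌋ ∧ adj G x y)))

Boundary : (G : Graph) → Fin (V G) → Set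
Boundary G x = deg G x ≡ 1

data Reach (G : Graph) : Fin (V G) → Fin (V G) → Set where
  here : ∀ {x} → Reach G x x
  step : ∀ {x y z} → T (adj G x y) → Reach G y z → Reach G x z

Connected : Graph → Set
Connected G = ∀ x y → Reach G x y

edgeVariation : (G : Graph) → (Fin (V G) → ℚ) → ℚ
edgeVariation G f =
  sumℚ (λ x → sumℚ (λ y →
    if ⌊ x <? y ⌋ ∧ adj G x y then ∣ f x - f y ∣ else 0ℚ))

mass : (G : Graph) → (Fin (V G) → ℚ) → ℚ
mass G f = sumℚ (λ x → ∣ f x ∣)

Admissible : (G : Graph) → (Fin (V G) → ℚ) → Set
Admissible G f = (∃ λ x → f x ≢ 0ℚ) × (∀ x → Boundary G x → f x ≡ 0ℚ)

-- λ is the first 1-Dirichlet eigenvalue λ_{1,1}(G): the minimum of the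
-- Rayleigh quotient edgeVariation/mass over admissible f (written
-- multiplicatively, mass f > 0 for admissible f): it is attained, and it is
-- a lower bound.
IsLambda11 : (G : Graph) → ℚ → Set
IsLambda11 G λ₁ =
  (∃ λ f → Admissible G f × edgeVariation G f ≡ λ₁ * mass G f)
  × (∀ f → Admissible G f → λ₁ * mass G f ≤ edgeVariation G f)

-- tadpole graph T_{n,i} on vertices t_1..t_n (t_k is index k-1):
-- path edges {t_k, t_{k+1}} and the extra edge {t_1, t_i}.
tadAdjℕ : ℕ → ℕ → ℕ → Bool
tadAdjℕ i a b =
  (b ≡ᵇ suc a) ∨ (a ≡ᵇ suc b)
  ∨ ((a ≡ᵇ 0) ∧ (b ≡ᵇ (i ∸ 1))) ∨ ((b ≡ᵇ 0) ∧ (a ≡ᵇ (i ∸ 1)))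

tadAdj : (n i : ℕ) → Fin n → Fin n → Bool
tadAdj n i a b = tadAdjℕ i (toℕ a) (toℕ b)

IsoTadpole : Graph → ℕ → ℕ → Set
IsoTadpole G n i =
  Σ (Fin (V G) ↔ Fin n) λ σ →
    ∀ x y → adj G x y ≡ tadAdj n i (Inverse.to σ x) (Inverse.to σ y)

{-# OPTIONS --safe #-}
-- λ₁ is the Dirichlet Cheeger constant. For g ≥ 0 vanishing on the boundary, with support U and
-- least positive value m, the function g − m·χ_U is again admissible with a smaller support, and
-- both Σ g and the edge variation split exactly along g = m·χ_U + (g − m·χ_U); by induction on
-- the support, λ₁ Σ g ≤ Σ_{xy} |g x − g y| as soon as λ₁ |U| ≤ |∂U| for every interior set U,
-- and a minimising interior set shows the bound is attained.
-- For a nonempty interior U, connectivity gives |∂U| ≥ 1, and since the vertices of U have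
-- degree ≥ 2 while the pendant vertex lies outside U, 2|U| + 1 ≤ Σ deg = 2n, so |U| ≤ n − 1.
-- Equality forces |∂U| = 1 and |U| = n − 1; as Σ_{x∈U} deg x = 2e(U) + |∂U| is odd, only the
-- pendant vertex lies outside U, one vertex has degree 3 and all others degree 2, and the
-- non-backtracking walk from the pendant vertex traces out T_{n,i}. Conversely, in T_{n,i} the
-- set of all vertices but t_n has |∂U| = 1 and |U| = n − 1.
module Submission where

open import Defs hiding (sym)
open import Data.Nat using (ℕ; zero; suc; z≤n; s≤s; _≤_; _<_; _∸_)
import Data.Nat as ℕ
import Data.Nat.Properties as ℕₚ
open import Data.Rational using (ℚ; 1ℚ; _/_) renaming (_≤_ to _≤ℚ_)
import Data.Rational as ℚ
import Data.Rational.Properties as ℚₚ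
open import Data.Fin using (Fin; zero; suc; toℕ; fromℕ<; _<?_)
open import Data.Fin.Properties using (_≟_)
import Data.Fin.Properties as Finₚ
open import Data.Fin.Permutation using (↔⇒≡)
open import Data.Bool using (Bool; true; false; T; not; _∧_; _∨_; _xor_; if_then_else_)
open import Data.Bool.Properties using (T-≡; T-∨; T-∧; not-involutive; ⇔→≡)
open import Data.List using (List; []; _∷_; length; map; allFin)
open import Data.List.Membership.Propositional using (_∈_)
open import Data.List.Membership.Propositional.Properties using (∈-allFin)
open import Data.List.Relation.Unary.All using (All; []; _∷_)
open import Data.List.Relation.Unary.All.Properties using (¬Any⇒All¬)
open import Data.List.Relation.Unary.AllPairs using ([]; _∷_)
open import Data.List.Relation.Unary.Any using (here; there)
open import Data.List.Relation.Unary.Unique.Propositional using (Unique)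
open import Data.Nat.ListAction using (sum)
open import Data.Vec using (Vec; []; _∷_)
import Data.Vec as Vec
import Data.Vec.Properties as VecP
open import Data.Product using (Σ; ∃; _×_; _,_; proj₁; proj₂)
open import Data.Sum using (_⊎_; inj₁; inj₂)
open import Data.Empty using (⊥-elim)
open import Function using (_∘_)
open import Function.Bundles using (_⇔_; Equivalence; Inverse; _↔_; mk↔ₛ′; mk⇔)
import Function.Properties.Equivalence as ⇔
open import Relation.Binary using (tri<; tri≈; tri>; DecTotalOrder)
open import Relation.Binary.PropositionalEquality
  using (_≡_; _≢_; refl; sym; trans; cong; cong₂; subst; subst₂; module ≡-Reasoning)
open import Relation.Nullary using (¬_; yes; no; does; Dec; ¬?)
open import Relation.Nullary.Decidable using (⌊_⌋; T?; _×-dec_; dec-true; decidable-stable)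
open import Relation.Unary using (Decidable)

module FinSum where
  open import Data.Nat using (_+_)
  open import Algebra.Properties.CommutativeSemigroup ℕₚ.+-commutativeSemigroup using (interchange; x∙yz≈y∙xz)

  sumℕ-cong : ∀ {k} {f g : Fin k → ℕ} → (∀ i → f i ≡ g i) → sumℕ f ≡ sumℕ g
  sumℕ-cong {zero}  f≗g = refl
  sumℕ-cong {suc k} f≗g = cong₂ _+_ (f≗g zero) (sumℕ-cong (λ i → f≗g (suc i)))

  sumℕ-+ : ∀ {k} (f g : Fin k → ℕ) → sumℕ (λ i → f i + g i) ≡ sumℕ f + sumℕ g
  sumℕ-+ {zero}  f g = refl
  sumℕ-+ {suc k} f g = trans (cong (f zero + g zero +_) (sumℕ-+ (f ∘ suc) (g ∘ suc)))
                             (interchange (f zero) (g zero) (sumℕ (f ∘ suc)) (sumℕ (g ∘ suc)))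

  sumℕ-zeros : ∀ k → sumℕ {k} (λ _ → 0) ≡ 0
  sumℕ-zeros zero    = refl
  sumℕ-zeros (suc k) = sumℕ-zeros k

  sumℕ-ones : ∀ k → sumℕ {k} (λ _ → 1) ≡ k
  sumℕ-ones zero    = refl
  sumℕ-ones (suc k) = cong suc (sumℕ-ones k)

  sumℕ-mono-≤ : ∀ {k} {f g : Fin k → ℕ} → (∀ i → f i ≤ g i) → sumℕ f ≤ sumℕ g
  sumℕ-mono-≤ {zero}  f≤g = z≤n
  sumℕ-mono-≤ {suc k} f≤g = ℕₚ.+-mono-≤ (f≤g zero) (sumℕ-mono-≤ (λ i → f≤g (suc i)))

  sumℕ-mono-< : ∀ {k} {f g : Fin k → ℕ} → (∀ i → f i ≤ g i) → ∀ j → f j < g j → sumℕ f < sumℕ g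
  sumℕ-mono-< f≤g zero    fj<gj = ℕₚ.+-mono-<-≤ fj<gj (sumℕ-mono-≤ (λ i → f≤g (suc i)))
  sumℕ-mono-< f≤g (suc j) fj<gj = ℕₚ.+-mono-≤-< (f≤g zero) (sumℕ-mono-< (λ i → f≤g (suc i)) j fj<gj)

  sumℕ-comm : ∀ {k l} (f : Fin k → Fin l → ℕ) →
              sumℕ (λ x → sumℕ (λ y → f x y)) ≡ sumℕ (λ y → sumℕ (λ x → f x y))
  sumℕ-comm {zero}  {l} f = sym (sumℕ-zeros l)
  sumℕ-comm {suc k} {l} f = trans (cong (sumℕ (f zero) +_) (sumℕ-comm (λ x → f (suc x))))
                                  (sym (sumℕ-+ (f zero) (λ y → sumℕ (λ x → f (suc x) y))))

  sumℕ₂-+ : ∀ {k l} (f g : Fin k → Fin l → ℕ) →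
            sumℕ (λ x → sumℕ (λ y → f x y + g x y)) ≡ sumℕ (λ x → sumℕ (f x)) + sumℕ (λ x → sumℕ (g x))
  sumℕ₂-+ f g = trans (sumℕ-cong (λ x → sumℕ-+ (f x) (g x))) (sumℕ-+ (λ x → sumℕ (f x)) (λ x → sumℕ (g x)))

  sumℕ-≥-term : ∀ {k} (f : Fin k → ℕ) i → f i ≤ sumℕ f
  sumℕ-≥-term f zero    = ℕₚ.m≤m+n (f zero) _
  sumℕ-≥-term f (suc i) = ℕₚ.≤-trans (sumℕ-≥-term (λ j → f (suc j)) i) (ℕₚ.m≤n+m _ (f zero))

  sumℕ-pos : ∀ {k} (f : Fin k → ℕ) → 0 < sumℕ f → ∃ λ i → 0 < f i
  sumℕ-pos {suc k} f pos with f zero in eq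
  ... | suc _ = zero , subst (0 <_) (sym eq) (s≤s z≤n)
  ... | zero  with sumℕ-pos (λ i → f (suc i)) pos
  ...   | i , fi>0 = suc i , fi>0

  sumℕ-if : ∀ {k} b (f : Fin k → ℕ) → sumℕ (λ i → if b then f i else 0) ≡ (if b then sumℕ f else 0)
  sumℕ-if     true  f = refl
  sumℕ-if {k} false f = sumℕ-zeros k

  sumℕ-singleton : ∀ {k} (p : Fin k) (f : Fin k → ℕ) → sumℕ (λ i → if does (i ≟ p) then f i else 0) ≡ f p
  sumℕ-singleton {suc k} zero    f = trans (cong (f zero +_) (sumℕ-zeros k)) (ℕₚ.+-identityʳ (f zero))
  sumℕ-singleton          (suc p) f = sumℕ-singleton p (λ i → f (suc i))

  zeroAt : ∀ {k} → Fin k → (Fin k → ℕ) → Fin k → ℕ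
  zeroAt p f i = if does (i ≟ p) then 0 else f i

  zeroAt-≢ : ∀ {k} {p i : Fin k} (f : Fin k → ℕ) → i ≢ p → zeroAt p f i ≡ f i
  zeroAt-≢ {p = p} {i} f i≢p with i ≟ p
  ... | yes i≡p = ⊥-elim (i≢p i≡p)
  ... | no  _   = refl

  sumℕ-zeroAt : ∀ {k} (p : Fin k) (f : Fin k → ℕ) → sumℕ f ≡ f p + sumℕ (zeroAt p f)
  sumℕ-zeroAt zero    f = refl
  sumℕ-zeroAt (suc p) f = trans (cong (f zero +_) (sumℕ-zeroAt p (f ∘ suc)))
                                (x∙yz≈y∙xz (f zero) (f (suc p)) (sumℕ (zeroAt p (f ∘ suc))))

  sumℕ-≥-distinct : ∀ {k} (f : Fin k → ℕ) {ps : List (Fin k)} → Unique ps → sum (map f ps) ≤ sumℕ f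
  sumℕ-≥-distinct f []                     = z≤n
  sumℕ-≥-distinct f {p ∷ ps} (p∉ps ∷ uniq) = begin
    f p + sum (map f ps)            ≡⟨ cong (f p +_) (sum-map-zeroAt p∉ps) ⟩
    f p + sum (map (zeroAt p f) ps) ≤⟨ ℕₚ.+-monoʳ-≤ (f p) (sumℕ-≥-distinct (zeroAt p f) uniq) ⟩
    f p + sumℕ (zeroAt p f)         ≡⟨ sumℕ-zeroAt p f ⟨
    sumℕ f                          ∎
    where
    open ℕₚ.≤-Reasoning
    sum-map-zeroAt : ∀ {qs} → All (p ≢_) qs → sum (map f qs) ≡ sum (map (zeroAt p f) qs)
    sum-map-zeroAt []            = refl
    sum-map-zeroAt (p≢q ∷ p∉qs) = cong₂ _+_ (sym (zeroAt-≢ f (p≢q ∘ sym))) (sum-map-zeroAt p∉qs)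

  sumℕ-≥-two : ∀ {k} (f : Fin k → ℕ) {p q} → p ≢ q → f p + f q ≤ sumℕ f
  sumℕ-≥-two f {p} {q} p≢q = subst (_≤ sumℕ f) (cong (f p +_) (ℕₚ.+-identityʳ (f q)))
                                 (sumℕ-≥-distinct f ((p≢q ∷ []) ∷ [] ∷ []))

  sumOver : ∀ {k} → (Fin k → Bool) → (Fin k → ℕ) → ℕ
  sumOver U f = sumℕ (λ i → if U i then f i else 0)

  sumOver-split : ∀ {k} (U : Fin k → Bool) (f : Fin k → ℕ) → sumOver U f + sumOver (not ∘ U) f ≡ sumℕ f
  sumOver-split U f = trans (sym (sumℕ-+ (λ i → if U i then f i else 0) (λ i → if not (U i) then f i else 0))) (sumℕ-cong split)
    where
    split : ∀ i → (if U i then f i else 0) + (if not (U i) then f i else 0) ≡ f i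
    split i with U i
    ... | true  = ℕₚ.+-identityʳ (f i)
    ... | false = refl

module Arithmetic where
  open import Data.Nat using (_+_)

  m+m<n+n⇒m<n : ∀ {m n} → m + m < n + n → m < n
  m+m<n+n⇒m<n {m} {n} lt with m ℕₚ.<? n
  ... | yes m<n = m<n
  ... | no  m≮n = ⊥-elim (ℕₚ.<⇒≱ lt (ℕₚ.+-mono-≤ n≤m n≤m))
    where n≤m = ℕₚ.≮⇒≥ m≮n

  m+m≤1+n+n⇒m≤n : ∀ {m n} → m + m ≤ suc (n + n) → m ≤ n
  m+m≤1+n+n⇒m≤n {m} {n} le with m ℕₚ.≤? n
  ... | yes m≤n = m≤n
  ... | no  m≰n = ⊥-elim (ℕₚ.<⇒≱ (subst (_≤ m + m) (cong suc (ℕₚ.+-suc n n)) (ℕₚ.+-mono-≤ n<m n<m)) le)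
    where n<m = ℕₚ.≰⇒> m≰n

  ≤-cases : ∀ {j k} → j ≤ k → j ≡ k ⊎ suc j ≡ k ⊎ suc (suc j) ≤ k
  ≤-cases j≤k with ℕₚ.m≤n⇒m<n∨m≡n j≤k
  ... | inj₂ j≡k = inj₁ j≡k
  ... | inj₁ j<k with ℕₚ.m≤n⇒m<n∨m≡n j<k
  ...   | inj₂ 1+j≡k  = inj₂ (inj₁ 1+j≡k)
  ...   | inj₁ 1+j<k = inj₂ (inj₂ 1+j<k)

  T-injective : ∀ {a b} → T a ⇔ T b → a ≡ b
  T-injective a⇔b = ⇔→≡ {z = true} (⇔.trans (⇔.sym T-≡) (⇔.trans a⇔b T-≡))

  m∸1+n<m : ∀ {m} n → 0 < m → m ∸ suc n < m
  m∸1+n<m {suc m} n _ = s≤s (ℕₚ.m∸n≤m m n)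

  m*n≡o≤n⇒m≤1 : ∀ {m n o} → 0 < n → m ℕ.* n ≡ o → o ≤ n → m ≤ 1
  m*n≡o≤n⇒m≤1 {m} {suc n} _ m*n≡o o≤n =
    ℕₚ.*-cancelʳ-≤ m 1 (suc n) (subst₂ _≤_ (sym m*n≡o) (sym (ℕₚ.*-identityˡ (suc n))) o≤n)

  suc[n∸1]≡n : ∀ {n} → 0 < n → suc (n ∸ 1) ≡ n
  suc[n∸1]≡n {suc n} _ = refl

  ind-pos : ∀ {c} → 0 < ind c → c ≡ true
  ind-pos {true} _ = refl

  false≢true : false ≢ true
  false≢true ()

  if-pos : ∀ {c} → 0 < (if c then 1 else 0) → c ≡ true
  if-pos {true} _ = refl

  if-mono : ∀ {a b} → (a ≡ true → b ≡ true) → (if a then 1 else 0) ≤ (if b then 1 else 0)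
  if-mono {false} _   = z≤n
  if-mono {true}  a⇒b rewrite a⇒b refl = ℕₚ.≤-refl

module GraphCounting (G : Graph) where
  open import Data.Nat using (_+_)
  open Arithmetic using (ind-pos; if-pos)
  open import Data.List.Membership.DecPropositional (_≟_ {V G}) using (_∈?_)
  open FinSum

  Vertex : Set
  Vertex = Fin (V G)

  Adjacent : Vertex → Vertex → Set
  Adjacent x y = T (adj G x y)

  adjacent-sym : ∀ {x y} → Adjacent x y → Adjacent y x
  adjacent-sym {x} {y} = subst T (Graph.sym G x y)

  adjacent-irrefl : ∀ {x y} → Adjacent x y → x ≢ y
  adjacent-irrefl {x} x~x refl = subst T (irr G x) x~x

  ind-T : ∀ {b} → T b → ind b ≡ 1
  ind-T {true} _ = refl

  edge? : Vertex → Vertex → Bool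
  edge? x y = ⌊ x <? y ⌋ ∧ adj G x y

  #edges : (Vertex → Vertex → Bool) → ℕ
  #edges P = sumℕ (λ x → sumℕ (λ y → ind (P x y ∧ edge? x y)))

  cut : (Vertex → Bool) → ℕ
  cut U = #edges (λ x y → U x xor U y)

  card : (Vertex → Bool) → ℕ
  card U = sumOver U (λ _ → 1)

  card-split : ∀ U → card U + card (not ∘ U) ≡ V G
  card-split U = trans (sumOver-split U (λ _ → 1)) (sumℕ-ones (V G))

  Interior : (Vertex → Bool) → Set
  Interior U = ∀ x → U x ≡ true → ¬ Boundary G x

  cut-cong : ∀ {U W} → (∀ x → U x ≡ W x) → cut U ≡ cut W
  cut-cong U≗W = sumℕ-cong (λ x → sumℕ-cong (λ y → cong₂ (λ a c → ind ((a xor c) ∧ edge? x y)) (U≗W x) (U≗W y)))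

  card-cong : ∀ {U W} → (∀ x → U x ≡ W x) → card U ≡ card W
  card-cong U≗W = sumℕ-cong (λ x → cong (λ a → if a then 1 else 0) (U≗W x))

  card-pos : ∀ {U x} → U x ≡ true → 0 < card U
  card-pos {U} {x} Ux = ℕₚ.<-≤-trans (subst (λ c → 0 < (if c then 1 else 0)) (sym Ux) (s≤s z≤n))
                                    (sumℕ-≥-term (λ y → if U y then 1 else 0) x)

  member : ∀ {U} → 0 < card U → ∃ λ x → U x ≡ true
  member {U} nonempty with sumℕ-pos (λ x → if U x then 1 else 0) nonempty
  ... | x , pos = x , if-pos pos

  interior-∌-boundary : ∀ {U x} → Interior U → Boundary G x → U x ≡ false
  interior-∌-boundary {U} {x} U-interior x-pendant with U x in Ux
  ... | true  = ⊥-elim (U-interior x Ux x-pendant)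
  ... | false = refl

  edge?-both : ∀ x y → ind (edge? x y) + ind (edge? y x) ≡ ind (adj G x y)
  edge?-both x y with x <? y | y <? x
  ... | yes x<y | yes y<x = ⊥-elim (Finₚ.<-asym x<y y<x)
  ... | yes _   | no  _   = ℕₚ.+-identityʳ _
  ... | no  _   | yes _   = cong ind (Graph.sym G y x)
  ... | no  x≮y | no  y≮x with Finₚ.<-cmp x y
  ...   | tri< x<y _ _    = ⊥-elim (x≮y x<y)
  ...   | tri≈ _ refl _   = cong ind (sym (irr G x))
  ...   | tri> _ _ y<x    = ⊥-elim (y≮x y<x)

  handshake : ∀ (P : Vertex → Bool) → #edges (λ x _ → P x) + #edges (λ _ y → P y) ≡ sumOver P (deg G)
  handshake P = begin
    #edges (λ x _ → P x) + #edges (λ _ y → P y)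
      ≡⟨ cong (#edges (λ x _ → P x) +_) (sumℕ-comm (λ x y → ind (P y ∧ edge? x y))) ⟩
    sumℕ (λ x → sumℕ (out x)) + sumℕ (λ x → sumℕ (into x))
      ≡⟨ sumℕ₂-+ out into ⟨
    sumℕ (λ x → sumℕ (λ y → out x y + into x y))
      ≡⟨ sumℕ-cong (λ x → trans (sumℕ-cong (both x)) (sumℕ-if (P x) (λ y → ind (adj G x y)))) ⟩
    sumOver P (deg G)
      ∎
    where
    open ≡-Reasoning
    out into : Vertex → Vertex → ℕ
    out  x y = ind (P x ∧ edge? x y)
    into x y = ind (P x ∧ edge? y x)
    both : ∀ x y → out x y + into x y ≡ (if P x then ind (adj G x y) else 0)
    both x y with P x
    ... | true  = edge?-both x y
    ... | false = refl

  degree-sum : sumℕ (deg G) ≡ edgeCount G + edgeCount G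
  degree-sum = sym (handshake (λ _ → true))

  private
    ind-∧-parity : ∀ a b e → ind (a ∧ e) + ind (b ∧ e) ≡ ind ((a ∧ b) ∧ e) + ind ((a ∧ b) ∧ e) + ind ((a xor b) ∧ e)
    ind-∧-parity true  true  true  = refl
    ind-∧-parity true  true  false = refl
    ind-∧-parity true  false true  = refl
    ind-∧-parity true  false false = refl
    ind-∧-parity false true  true  = refl
    ind-∧-parity false true  false = refl
    ind-∧-parity false false true  = refl
    ind-∧-parity false false false = refl

  degree-sum-inside : ∀ U → let e = #edges (λ x y → U x ∧ U y) in sumOver U (deg G) ≡ e + e + cut U
  degree-sum-inside U = begin
    sumOver U (deg G)                                   ≡⟨ handshake U ⟨
    #edges (λ x _ → U x) + #edges (λ _ y → U y)         ≡⟨ sumℕ₂-+ (edgeInd (λ x _ → U x)) (edgeInd (λ _ y → U y)) ⟨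
    sumℕ (λ x → sumℕ (λ y → ind (U x ∧ edge? x y) + ind (U y ∧ edge? x y)))
      ≡⟨ sumℕ-cong (λ x → sumℕ-cong (λ y → ind-∧-parity (U x) (U y) (edge? x y))) ⟩
    sumℕ (λ x → sumℕ (λ y → inside x y + inside x y + edgeInd (λ x y → U x xor U y) x y))
      ≡⟨ sumℕ₂-+ (λ x y → inside x y + inside x y) (edgeInd (λ x y → U x xor U y)) ⟩
    sumℕ (λ x → sumℕ (λ y → inside x y + inside x y)) + cut U
      ≡⟨ cong (_+ cut U) (sumℕ₂-+ inside inside) ⟩
    #edges (λ x y → U x ∧ U y) + #edges (λ x y → U x ∧ U y) + cut U
      ∎
    where
    open ≡-Reasoning
    edgeInd : (Vertex → Vertex → Bool) → Vertex → Vertex → ℕ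
    edgeInd P x y = ind (P x y ∧ edge? x y)
    inside : Vertex → Vertex → ℕ
    inside = edgeInd (λ x y → U x ∧ U y)

  cut-≤-degree-sum : ∀ U → cut U ≤ sumOver U (deg G)
  cut-≤-degree-sum U = subst (cut U ≤_) (sym (degree-sum-inside U)) (ℕₚ.m≤n+m (cut U) _)

  cut-complement : ∀ U → cut (not ∘ U) ≡ cut U
  cut-complement U = sumℕ-cong (λ x → sumℕ-cong (λ y → cong (λ b → ind (b ∧ edge? x y)) (not-xor-not (U x) (U y))))
    where
    not-xor-not : ∀ a b → (not a xor not b) ≡ (a xor b)
    not-xor-not true  true  = refl
    not-xor-not true  false = refl
    not-xor-not false true  = refl
    not-xor-not false false = refl

  deg-≥-length : ∀ {x ys} → Unique ys → All (Adjacent x) ys → length ys ≤ deg G x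
  deg-≥-length {x} {ys} uniq x~ys = subst (_≤ deg G x) (count x~ys) (sumℕ-≥-distinct (λ y → ind (adj G x y)) uniq)
    where
    count : ∀ {zs} → All (Adjacent x) zs → sum (map (λ y → ind (adj G x y)) zs) ≡ length zs
    count []            = refl
    count (x~z ∷ x~zs) = cong₂ _+_ (ind-T x~z) (count x~zs)

  neighbour-∈ : ∀ {x ys z} → Unique ys → All (Adjacent x) ys → deg G x ≡ length ys → Adjacent x z → z ∈ ys
  neighbour-∈ {x} {ys} {z} uniq x~ys deg≡ x~z with z ∈? ys
  ... | yes z∈ys = z∈ys
  ... | no  z∉ys = ⊥-elim (ℕₚ.n≮n (length ys)
                     (subst (length ys <_) deg≡ (deg-≥-length (¬Any⇒All¬ ys z∉ys ∷ uniq) (x~z ∷ x~ys))))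

  unique-neighbour : ∀ {x y z} → Boundary G x → Adjacent x y → Adjacent x z → z ≡ y
  unique-neighbour x-pendant x~y x~z with neighbour-∈ ([] ∷ []) (x~y ∷ []) x-pendant x~z
  ... | here z≡y = z≡y

  neighbour-of-two : ∀ {x p q y} → deg G x ≡ 2 → Adjacent x p → Adjacent x q → p ≢ q → Adjacent x y → y ≡ p ⊎ y ≡ q
  neighbour-of-two deg≡2 x~p x~q p≢q x~y with neighbour-∈ ((p≢q ∷ []) ∷ [] ∷ []) (x~p ∷ x~q ∷ []) deg≡2 x~y
  ... | here y≡p         = inj₁ y≡p
  ... | there (here y≡q) = inj₂ y≡q

  deg-≤-1 : ∀ {x p} → (∀ y → Adjacent x y → y ≡ p) → deg G x ≤ 1
  deg-≤-1 {x} {p} only-p = ℕₚ.≤-trans (sumℕ-mono-≤ at-most-p) (ℕₚ.≤-reflexive (sumℕ-singleton p (λ _ → 1)))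
    where
    at-most-p : ∀ y → ind (adj G x y) ≤ (if does (y ≟ p) then 1 else 0)
    at-most-p y with adj G x y in x~y
    ... | false = z≤n
    ... | true  rewrite only-p y (subst T (sym x~y) _) | dec-true (p ≟ p) refl = ℕₚ.≤-refl

  neighbour-exists : ∀ {x} → 1 ≤ deg G x → ∃ λ y → Adjacent x y
  neighbour-exists {x} 1≤deg with sumℕ-pos (λ y → ind (adj G x y)) 1≤deg
  ... | y , pos = y , Equivalence.from T-≡ (ind-pos pos)

  module PendantNeighbour {b} (b-pendant : Boundary G b) where

    b′ : Vertex
    b′ = proj₁ (neighbour-exists (ℕₚ.≤-reflexive (sym b-pendant)))

    b~b′ : Adjacent b b′
    b~b′ = proj₂ (neighbour-exists (ℕₚ.≤-reflexive (sym b-pendant)))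

  reach-closed : (S : Vertex → Set) → (∀ {x y} → S x → Adjacent x y → S y) → ∀ {x y} → S x → Reach G x y → S y
  reach-closed S closed Sx here           = Sx
  reach-closed S closed Sx (step x~y y⇝z) = reach-closed S closed (closed Sx x~y) y⇝z

  edge?-true : ∀ {x y} → toℕ x < toℕ y → Adjacent x y → edge? x y ≡ true
  edge?-true {x} {y} x<y x~y with x <? y
  ... | yes _   = Equivalence.to T-≡ x~y
  ... | no  x≮y = ⊥-elim (x≮y x<y)

  #edges-≥-1 : ∀ {P x y} → P x y ≡ true → edge? x y ≡ true → 1 ≤ #edges P
  #edges-≥-1 {P} {x} {y} Pxy xy = ℕₚ.≤-trans (ℕₚ.≤-reflexive (sym (cong₂ (λ a b → ind (a ∧ b)) Pxy xy)))
    (ℕₚ.≤-trans (sumℕ-≥-term (λ y → ind (P x y ∧ edge? x y)) y)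
                (sumℕ-≥-term (λ x → sumℕ (λ y → ind (P x y ∧ edge? x y))) x))

  edge-crosses-cut : ∀ {U a b} → Adjacent a b → U a ≡ true → U b ≡ false → 1 ≤ cut U
  edge-crosses-cut {U} {a} {b} a~b Ua Ub with Finₚ.<-cmp a b
  ... | tri< a<b _ _ = #edges-≥-1 {λ x y → U x xor U y} (cong₂ _xor_ Ua Ub) (edge?-true a<b a~b)
  ... | tri≈ _ a≡b _ = ⊥-elim (adjacent-irrefl a~b a≡b)
  ... | tri> _ _ b<a = #edges-≥-1 {λ x y → U x xor U y} (cong₂ _xor_ Ub Ua) (edge?-true b<a (adjacent-sym a~b))

  reach-crosses-cut : ∀ {U x z} → Reach G x z → U x ≡ true → U z ≡ false → 1 ≤ cut U
  reach-crosses-cut here Ux Uz with trans (sym Ux) Uz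
  ... | ()
  reach-crosses-cut {U} (step {y = y} x~y y⇝z) Ux Uz with U y in Uy
  ... | true  = reach-crosses-cut y⇝z Uy Uz
  ... | false = edge-crosses-cut x~y Ux Uy

module ChordedPath where

  -- The path 0 — 1 — 2 — ⋯ together with one extra edge {u, v}; T_{n,i} is Chorded 0 (i ∸ 1) on 0 … n ∸ 1.
  data Chorded (u v : ℕ) : ℕ → ℕ → Set where
    step   : ∀ {a} → Chorded u v a (suc a)
    step⁻  : ∀ {a} → Chorded u v (suc a) a
    chord  : Chorded u v u v
    chord⁻ : Chorded u v v u

  tadAdjℕ⇒Chorded : ∀ i a b → T (tadAdjℕ i a b) → Chorded 0 (i ∸ 1) a b
  tadAdjℕ⇒Chorded i a b t with Equivalence.to T-∨ t
  ... | inj₁ b≡1+a with ℕₚ.≡ᵇ⇒≡ b (suc a) b≡1+a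
  ...   | refl = step
  tadAdjℕ⇒Chorded i a b t | inj₂ t′ with Equivalence.to T-∨ t′
  ... | inj₁ a≡1+b with ℕₚ.≡ᵇ⇒≡ a (suc b) a≡1+b
  ...   | refl = step⁻
  tadAdjℕ⇒Chorded i a b t | inj₂ t′ | inj₂ t″ with Equivalence.to T-∨ t″
  ... | inj₁ t‴ with Equivalence.to T-∧ t‴
  ...   | a≡0 , b≡c with ℕₚ.≡ᵇ⇒≡ a 0 a≡0 | ℕₚ.≡ᵇ⇒≡ b (i ∸ 1) b≡c
  ...     | refl | refl = chord
  tadAdjℕ⇒Chorded i a b t | inj₂ t′ | inj₂ t″ | inj₂ t‴ with Equivalence.to T-∧ t‴
  ...   | b≡0 , a≡c with ℕₚ.≡ᵇ⇒≡ b 0 b≡0 | ℕₚ.≡ᵇ⇒≡ a (i ∸ 1) a≡c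
  ...     | refl | refl = chord⁻

  private
    T-∨ˡ : ∀ {x} y → T x → T (x ∨ y)
    T-∨ˡ {true} y _ = _

    T-∨ʳ : ∀ x {y} → T y → T (x ∨ y)
    T-∨ʳ true  _ = _
    T-∨ʳ false t = t

  Chorded⇒tadAdjℕ : ∀ {i a b} → Chorded 0 (i ∸ 1) a b → T (tadAdjℕ i a b)
  Chorded⇒tadAdjℕ {i} {a} step      = T-∨ˡ _ (ℕₚ.≡⇒≡ᵇ a a refl)
  Chorded⇒tadAdjℕ {i} {_} {b} step⁻ = T-∨ʳ (b ℕ.≡ᵇ suc (suc b)) (T-∨ˡ _ (ℕₚ.≡⇒≡ᵇ b b refl))
  Chorded⇒tadAdjℕ {i} chord         = T-∨ʳ (i ∸ 1 ℕ.≡ᵇ 1) (T-∨ˡ _ (ℕₚ.≡⇒≡ᵇ (i ∸ 1) (i ∸ 1) refl))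
  Chorded⇒tadAdjℕ {i} chord⁻        = T-∨ʳ (i ∸ 1 ℕ.≡ᵇ 1)
                                        (T-∨ʳ ((i ∸ 1 ℕ.≡ᵇ 0) ∧ (0 ℕ.≡ᵇ i ∸ 1)) (ℕₚ.≡⇒≡ᵇ (i ∸ 1) (i ∸ 1) refl))

  Chorded-sym : ∀ {u v a b} → Chorded u v a b → Chorded u v b a
  Chorded-sym step   = step⁻
  Chorded-sym step⁻  = step
  Chorded-sym chord  = chord⁻
  Chorded-sym chord⁻ = chord

  private
    m∸n≡1+m∸[1+n] : ∀ {m n} → n < m → m ∸ n ≡ suc (m ∸ suc n)
    m∸n≡1+m∸[1+n] {suc m} {zero}  _         = refl
    m∸n≡1+m∸[1+n] {suc m} {suc n} (s≤s n<m) = m∸n≡1+m∸[1+n] n<m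

    reflect-step : ∀ {N u v a} → suc a ≤ N → Chorded u v (N ∸ a) (N ∸ suc a)
    reflect-step a<N rewrite m∸n≡1+m∸[1+n] a<N = step⁻

  Chorded-reflect : ∀ {N u v a b} → a ≤ N → b ≤ N → Chorded u v a b → Chorded (N ∸ u) (N ∸ v) (N ∸ a) (N ∸ b)
  Chorded-reflect _     a<N step   = reflect-step a<N
  Chorded-reflect b<N   _   step⁻  = Chorded-sym (reflect-step b<N)
  Chorded-reflect _     _   chord  = chord
  Chorded-reflect _     _   chord⁻ = chord⁻

  Chorded-unreflect : ∀ {N u v a b} → u ≤ N → v ≤ N → a ≤ N → b ≤ N →
                      Chorded (N ∸ u) (N ∸ v) (N ∸ a) (N ∸ b) → Chorded u v a b
  Chorded-unreflect {N} {a = a} {b} u≤N v≤N a≤N b≤N e =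
    Chorded-cong (ℕₚ.m∸[m∸n]≡n u≤N) (ℕₚ.m∸[m∸n]≡n v≤N) (ℕₚ.m∸[m∸n]≡n a≤N) (ℕₚ.m∸[m∸n]≡n b≤N)
                 (Chorded-reflect (ℕₚ.m∸n≤m N a) (ℕₚ.m∸n≤m N b) e)
    where
    Chorded-cong : ∀ {u u′ v v′ a a′ b b′} → u ≡ u′ → v ≡ v′ → a ≡ a′ → b ≡ b′ →
                   Chorded u v a b → Chorded u′ v′ a′ b′
    Chorded-cong refl refl refl refl e = e

module PendantGraph (n : ℕ) (G : Graph) (conn : Connected G) (edges : edgeCount G ≡ n)
                    (b : Fin (V G)) (b-pendant : Boundary G b) where
  open import Data.Nat using (_+_)
  open FinSum
  open GraphCounting G
  open Arithmetic

  degree-sum≡ : sumℕ (deg G) ≡ n + n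
  degree-sum≡ = trans degree-sum (cong₂ _+_ edges edges)

  deg-pos : ∀ x → 1 ≤ deg G x
  deg-pos x with conn x b
  ... | here         = ℕₚ.≤-reflexive (sym b-pendant)
  ... | step x~y _   = deg-≥-length ([] ∷ []) (x~y ∷ [])

  open PendantNeighbour b-pendant

  -- If b′ were pendant too, {b, b′} would be a whole component carrying a single edge.
  b′-not-pendant : 1 < n → ¬ Boundary G b′
  b′-not-pendant 1<n b′-pendant = ℕₚ.<⇒≱ 2<degree-sum degree-sum≤2
    where
    S : Vertex → Set
    S x = x ≡ b ⊎ x ≡ b′
    closed : ∀ {x y} → S x → Adjacent x y → S y
    closed (inj₁ refl) x~y = inj₂ (unique-neighbour b-pendant b~b′ x~y)
    closed (inj₂ refl) x~y = inj₁ (unique-neighbour b′-pendant (adjacent-sym b~b′) x~y)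
    δ : Vertex → Vertex → ℕ
    δ p x = if does (x ≟ p) then 1 else 0
    δ-self : ∀ p → δ p p ≡ 1
    δ-self p = cong (λ c → if c then 1 else 0) (dec-true (p ≟ p) refl)
    deg≤ : ∀ x → deg G x ≤ δ b x + δ b′ x
    deg≤ x with reach-closed S closed (inj₁ refl) (conn b x)
    ... | inj₁ refl = subst₂ _≤_ (sym b-pendant)  (cong (_+ δ b′ b) (sym (δ-self b)))  (ℕₚ.m≤m+n 1 (δ b′ b))
    ... | inj₂ refl = subst₂ _≤_ (sym b′-pendant) (cong (δ b b′ +_) (sym (δ-self b′))) (ℕₚ.m≤n+m 1 (δ b b′))
    degree-sum≤2 : sumℕ (deg G) ≤ 2
    degree-sum≤2 = ℕₚ.≤-trans (sumℕ-mono-≤ deg≤)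
      (ℕₚ.≤-reflexive (trans (sumℕ-+ (δ b) (δ b′)) (cong₂ _+_ (sumℕ-singleton b (λ _ → 1)) (sumℕ-singleton b′ (λ _ → 1)))))
    2<degree-sum : 2 < sumℕ (deg G)
    2<degree-sum = subst (2 <_) (sym degree-sum≡) (ℕₚ.+-mono-< 1<n 1<n)

  Ω : Vertex → Bool
  Ω x = not ⌊ deg G x ℕₚ.≟ 1 ⌋

  Ω-interior : Interior Ω
  Ω-interior x Ωx x-pendant with deg G x ℕₚ.≟ 1
  ... | no  x-not-pendant = x-not-pendant x-pendant
  Ω-interior x () x-pendant | yes _

  Ω-nonempty : 1 < n → 0 < card Ω
  Ω-nonempty 1<n = card-pos {x = b′} b′∈Ω
    where
    b′∈Ω : Ω b′ ≡ true
    b′∈Ω with deg G b′ ℕₚ.≟ 1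
    ... | yes b′-pendant = ⊥-elim (b′-not-pendant 1<n b′-pendant)
    ... | no  _          = refl

  module _ {U : Vertex → Bool} (U-interior : Interior U) where

    b∉U : U b ≡ false
    b∉U = interior-∌-boundary U-interior b-pendant

    interior-deg-≥-2 : ∀ {x} → U x ≡ true → 2 ≤ deg G x
    interior-deg-≥-2 {x} Ux = ℕₚ.≤∧≢⇒< (deg-pos x) (λ 1≡deg → U-interior x Ux (sym 1≡deg))

    twice-card-≤ : card U + card U ≤ sumOver U (deg G)
    twice-card-≤ = subst (_≤ sumOver U (deg G)) (sumℕ-+ one one) (sumℕ-mono-≤ pointwise)
      where
      one : Vertex → ℕ
      one x = if U x then 1 else 0
      pointwise : ∀ x → one x + one x ≤ (if U x then deg G x else 0)
      pointwise x with U x in Ux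
      ... | true  = interior-deg-≥-2 Ux
      ... | false = z≤n

    outside-≥-1 : 1 ≤ sumOver (not ∘ U) (deg G)
    outside-≥-1 = ℕₚ.≤-trans b-term (sumℕ-≥-term (λ x → if not (U x) then deg G x else 0) b)
      where
      b-term : 1 ≤ (if not (U b) then deg G b else 0)
      b-term rewrite b∉U = ℕₚ.≤-reflexive (sym b-pendant)

    card-< : card U < n
    card-< = m+m<n+n⇒m<n (subst₂ _≤_ (ℕₚ.+-comm (card U + card U) 1) (trans (sumOver-split U (deg G)) degree-sum≡)
                                     (ℕₚ.+-mono-≤ twice-card-≤ outside-≥-1))

    cut-≥-1 : 0 < card U → 1 ≤ cut U
    cut-≥-1 nonempty = reach-crosses-cut (conn (proj₁ (member nonempty)) b) (proj₂ (member nonempty)) b∉U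

    module Extremal (cut≡1 : cut U ≡ 1) (card≡ : suc (card U) ≡ n) where

      c D-in D-out : ℕ
      c     = card U
      D-in  = sumOver U (deg G)
      D-out = sumOver (not ∘ U) (deg G)

      D-total : D-in + D-out ≡ suc (c + c) + 1
      D-total = begin
        D-in + D-out  ≡⟨ trans (sumOver-split U (deg G)) degree-sum≡ ⟩
        n + n         ≡⟨ cong₂ _+_ card≡ card≡ ⟨
        suc c + suc c ≡⟨ cong suc (trans (ℕₚ.+-suc c c) (ℕₚ.+-comm 1 (c + c))) ⟩
        suc (c + c) + 1 ∎
        where open ≡-Reasoning

      -- D-in = 2 e(U) + cut U is odd and at least 2c, hence at least 2c + 1.
      D-in-≥ : suc (c + c) ≤ D-in
      D-in-≥ = subst (suc (c + c) ≤_) (sym D-in-odd) (s≤s (ℕₚ.+-mono-≤ c≤e c≤e))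
        where
        e : ℕ
        e = #edges (λ x y → U x ∧ U y)
        D-in-odd : D-in ≡ suc (e + e)
        D-in-odd = trans (degree-sum-inside U) (trans (cong (e + e +_) cut≡1) (ℕₚ.+-comm (e + e) 1))
        c≤e : c ≤ e
        c≤e = m+m≤1+n+n⇒m≤n (subst (c + c ≤_) D-in-odd twice-card-≤)

      D-out≤1 : D-out ≤ 1
      D-out≤1 = ℕₚ.+-cancelˡ-≤ (suc (c + c)) D-out 1 (subst (suc (c + c) + D-out ≤_) D-total (ℕₚ.+-monoˡ-≤ D-out D-in-≥))

      D-in≡ : D-in ≡ suc (c + c)
      D-in≡ = ℕₚ.≤-antisym (ℕₚ.+-cancelʳ-≤ 1 D-in (suc (c + c)) (subst (D-in + 1 ≤_) D-total (ℕₚ.+-monoʳ-≤ D-in outside-≥-1)))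
                           D-in-≥

      excess : Vertex → ℕ
      excess x = if U x then deg G x ∸ 2 else 0

      excess-sum≡1 : sumℕ excess ≡ 1
      excess-sum≡1 = ℕₚ.+-cancelˡ-≡ (c + c) (sumℕ excess) 1 (begin
        c + c + sumℕ excess ≡⟨ D-in-split ⟨
        D-in                ≡⟨ D-in≡ ⟩
        suc (c + c)         ≡⟨ ℕₚ.+-comm 1 (c + c) ⟩
        c + c + 1           ∎)
        where
        open ≡-Reasoning
        one : Vertex → ℕ
        one x = if U x then 1 else 0
        pointwise : ∀ x → (if U x then deg G x else 0) ≡ one x + one x + excess x
        pointwise x with U x in Ux
        ... | true  = sym (ℕₚ.m+[n∸m]≡n (interior-deg-≥-2 Ux))
        ... | false = refl
        D-in-split : D-in ≡ c + c + sumℕ excess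
        D-in-split = trans (sumℕ-cong pointwise)
                     (trans (sumℕ-+ (λ x → one x + one x) excess) (cong (_+ sumℕ excess) (sumℕ-+ one one)))

      inside-all-but-b : ∀ x → x ≢ b → U x ≡ true
      inside-all-but-b x x≢b with U x in Ux
      ... | true  = refl
      ... | false = ⊥-elim (ℕₚ.<⇒≱ two-outside D-out≤1)
        where
        f : Vertex → ℕ
        f y = if not (U y) then deg G y else 0
        two-outside : 1 < D-out
        two-outside = ℕₚ.≤-trans (subst₂ (λ p q → 2 ≤ (if not p then deg G x else 0) + (if not q then deg G b else 0))
                                         (sym Ux) (sym b∉U) (ℕₚ.+-mono-≤ (deg-pos x) (deg-pos b)))
                                 (sumℕ-≥-two f x≢b)

      V≡n : V G ≡ n
      V≡n = begin
        V G                  ≡⟨ card-split U ⟨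
        c + card (not ∘ U)   ≡⟨ cong (c +_) (trans (sumℕ-cong outside-is-b) (sumℕ-singleton b (λ _ → 1))) ⟩
        c + 1                ≡⟨ ℕₚ.+-comm c 1 ⟩
        suc c                ≡⟨ card≡ ⟩
        n                    ∎
        where
        open ≡-Reasoning
        outside-is-b : ∀ x → (if not (U x) then 1 else 0) ≡ (if does (x ≟ b) then 1 else 0)
        outside-is-b x with x ≟ b
        ... | yes refl = cong (λ c → if not c then 1 else 0) b∉U
        ... | no  x≢b  = cong (λ c → if not c then 1 else 0) (inside-all-but-b x x≢b)

      excess-≡ : ∀ {x} → x ≢ b → excess x ≡ deg G x ∸ 2
      excess-≡ {x} x≢b = cong (λ c → if c then deg G x ∸ 2 else 0) (inside-all-but-b x x≢b)

      deg-2-or-3 : ∀ x → x ≢ b → deg G x ≡ 2 ⊎ deg G x ≡ 3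
      deg-2-or-3 x x≢b = small (interior-deg-≥-2 (inside-all-but-b x x≢b))
                               (subst (_≤ 1) (excess-≡ x≢b) (subst (excess x ≤_) excess-sum≡1 (sumℕ-≥-term excess x)))
        where
        small : ∀ {d} → 2 ≤ d → d ∸ 2 ≤ 1 → d ≡ 2 ⊎ d ≡ 3
        small {1} (s≤s ()) _
        small {2} _ _ = inj₁ refl
        small {3} _ _ = inj₂ refl
        small {suc (suc (suc (suc d)))} _ (s≤s ())

      deg-≥3-unique : ∀ {x y} → 3 ≤ deg G x → 3 ≤ deg G y → x ≡ y
      deg-≥3-unique {x} {y} 3≤x 3≤y with x ≟ y
      ... | yes x≡y = x≡y
      ... | no  x≢y = ⊥-elim (ℕₚ.<⇒≱ (ℕₚ.+-mono-≤ (at-least-1 3≤x) (at-least-1 3≤y))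
                                     (subst (excess x + excess y ≤_) excess-sum≡1 (sumℕ-≥-two excess x≢y)))
        where
        at-least-1 : ∀ {z} → 3 ≤ deg G z → 1 ≤ excess z
        at-least-1 {z} 3≤z = subst (1 ≤_) (sym (excess-≡ z≢b)) (ℕₚ.∸-monoˡ-≤ 2 3≤z)
          where
          z≢b : z ≢ b
          z≢b refl with subst (3 ≤_) b-pendant 3≤z
          ... | s≤s ()

  module FromTadpole {i : ℕ} (3≤i : 3 ≤ i) (i<n : i < n) (σ : Fin (V G) ↔ Fin n)
                     (σ-adj : ∀ x y → adj G x y ≡ tadAdj n i (Inverse.to σ x) (Inverse.to σ y)) where
    open ChordedPath

    index : Vertex → ℕ
    index x = toℕ (Inverse.to σ x)

    vertexAt : ∀ {a} → a < n → Vertex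
    vertexAt a<n = Inverse.from σ (fromℕ< a<n)

    index-vertexAt : ∀ {a} (a<n : a < n) → index (vertexAt a<n) ≡ a
    index-vertexAt a<n = trans (cong toℕ (Inverse.strictlyInverseˡ σ (fromℕ< a<n))) (Finₚ.toℕ-fromℕ< a<n)

    Chorded⇒adjacent : ∀ {x y} → Chorded 0 (i ∸ 1) (index x) (index y) → Adjacent x y
    Chorded⇒adjacent {x} {y} e = subst T (sym (σ-adj x y)) (Chorded⇒tadAdjℕ {i} e)

    1<n : 1 < n
    1<n = ℕₚ.<-trans (ℕₚ.≤-trans (s≤s (s≤s z≤n)) 3≤i) i<n

    n∸1<n : n ∸ 1 < n
    n∸1<n = ℕₚ.≤-reflexive (suc[n∸1]≡n (ℕₚ.<-trans (s≤s z≤n) 1<n))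

    last : Vertex
    last = vertexAt n∸1<n

    two-neighbours : ∀ k → k < n → k ≢ n ∸ 1 →
                     ∃ λ a → ∃ λ c → a < n × c < n × a ≢ c × Chorded 0 (i ∸ 1) k a × Chorded 0 (i ∸ 1) k c
    two-neighbours zero    _ _ = 1 , i ∸ 1 , 1<n ,
                                     ℕₚ.≤-<-trans (ℕₚ.m∸n≤m i 1) i<n , 1≢i∸1 3≤i , step , chord
      where
      1≢i∸1 : ∀ {j} → 3 ≤ j → 1 ≢ j ∸ 1
      1≢i∸1 (s≤s (s≤s (s≤s _))) ()
    two-neighbours (suc k) k<n k≢ = k , suc (suc k) , ℕₚ.<-trans (ℕₚ.n<1+n k) k<n ,
                                     ℕₚ.≤∧≢⇒< k<n (λ 2+k≡n → k≢ (cong (_∸ 1) 2+k≡n)) ,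
                                     (λ k≡2+k → ℕₚ.<-irrefl k≡2+k (ℕₚ.≤-trans (ℕₚ.n<1+n k) (ℕₚ.n≤1+n (suc k)))) ,
                                     step⁻ , step

    index-≢ : ∀ {x} → x ≢ last → index x ≢ n ∸ 1
    index-≢ {x} x≢last e = x≢last (trans (sym (Inverse.strictlyInverseʳ σ x))
                                         (cong (Inverse.from σ) (Finₚ.toℕ-injective (trans e (sym (Finₚ.toℕ-fromℕ< n∸1<n))))))

    non-last-deg-≥-2 : ∀ x → x ≢ last → 2 ≤ deg G x
    non-last-deg-≥-2 x x≢last with two-neighbours (index x) (Finₚ.toℕ<n (Inverse.to σ x)) (index-≢ x≢last)
    ... | a , c , a<n , c<n , a≢c , x~a , x~c =
      deg-≥-length (((λ va≡vc → a≢c (trans (sym (index-vertexAt a<n)) (trans (cong index va≡vc) (index-vertexAt c<n))))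
                      ∷ []) ∷ [] ∷ [])
                   (Chorded⇒adjacent (subst (Chorded 0 (i ∸ 1) (index x)) (sym (index-vertexAt a<n)) x~a) ∷
                    Chorded⇒adjacent (subst (Chorded 0 (i ∸ 1) (index x)) (sym (index-vertexAt c<n)) x~c) ∷ [])

    b≡last : b ≡ last
    b≡last with b ≟ last
    ... | yes b≡last = b≡last
    ... | no  b≢last = ⊥-elim (ℕₚ.<⇒≱ (non-last-deg-≥-2 b b≢last) (ℕₚ.≤-reflexive b-pendant))

    not-last : Vertex → Bool
    not-last x = not (does (x ≟ last))

    only-last : ∀ (f : Vertex → ℕ) → sumOver (not ∘ not-last) f ≡ f last
    only-last f = trans (sumℕ-cong (λ x → cong (λ c → if c then f x else 0) (not-involutive (does (x ≟ last)))))
                        (sumℕ-singleton last f)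

    not-last-interior : Interior not-last
    not-last-interior x x≢last x-pendant = ℕₚ.<⇒≱ (non-last-deg-≥-2 x (≢last x≢last)) (ℕₚ.≤-reflexive x-pendant)
      where
      ≢last : ∀ {x} → not-last x ≡ true → x ≢ last
      ≢last {x} nx refl rewrite dec-true (last ≟ last) refl with nx
      ... | ()

    card-not-last : card not-last ≡ n ∸ 1
    card-not-last = trans (sym (ℕₚ.m+n∸n≡m (card not-last) 1))
                          (cong (_∸ 1) (trans (cong (card not-last +_) (sym (only-last (λ _ → 1))))
                                              (trans (card-split not-last) (↔⇒≡ σ))))

    cut-not-last-≤-1 : cut not-last ≤ 1
    cut-not-last-≤-1 = begin
      cut not-last                        ≡⟨ cut-complement not-last ⟨
      cut (not ∘ not-last)                ≤⟨ cut-≤-degree-sum (not ∘ not-last) ⟩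
      sumOver (not ∘ not-last) (deg G)    ≡⟨ only-last (deg G) ⟩
      deg G last                          ≡⟨ cong (deg G) b≡last ⟨
      deg G b                             ≡⟨ b-pendant ⟩
      1                                   ∎
      where open ℕₚ.≤-Reasoning

module TadpoleRecognition (G : Graph) (conn : Connected G) (b : Fin (V G)) (b-pendant : Boundary G b)
                          (N : ℕ) (V≡1+N : V G ≡ suc N) (3≤N : 3 ≤ N)
                          (deg-2-or-3 : ∀ x → x ≢ b → deg G x ≡ 2 ⊎ deg G x ≡ 3)
                          (deg-≥3-unique : ∀ {x y} → 3 ≤ deg G x → 3 ≤ deg G y → x ≡ y) where
  open GraphCounting G
  open ChordedPath
  open Arithmetic

  open PendantNeighbour b-pendant

  non-b-deg-≥-2 : ∀ {x} → x ≢ b → 2 ≤ deg G x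
  non-b-deg-≥-2 {x} x≢b with deg-2-or-3 x x≢b
  ... | inj₁ deg≡2 = ℕₚ.≤-reflexive (sym deg≡2)
  ... | inj₂ deg≡3 = ℕₚ.≤-trans (ℕₚ.n≤1+n 2) (ℕₚ.≤-reflexive (sym deg≡3))

  other-neighbour? : ∀ x p → Dec (∃ λ y → Adjacent x y × y ≢ p)
  other-neighbour? x p = Finₚ.any? (λ y → T? (adj G x y) ×-dec ¬? (y ≟ p))

  otherNeighbour : Vertex → Vertex → Vertex
  otherNeighbour x p with other-neighbour? x p
  ... | yes (y , _) = y
  ... | no  _       = p

  otherNeighbour-spec : ∀ {x p} → 2 ≤ deg G x → Adjacent x (otherNeighbour x p) × otherNeighbour x p ≢ p
  otherNeighbour-spec {x} {p} 2≤deg with other-neighbour? x p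
  ... | yes (_ , x~y , y≢p) = x~y , y≢p
  ... | no  none            = ⊥-elim (ℕₚ.<⇒≱ 2≤deg (deg-≤-1 only-p))
    where
    only-p : ∀ y → Adjacent x y → y ≡ p
    only-p y x~y with y ≟ p
    ... | yes y≡p = y≡p
    ... | no  y≢p = ⊥-elim (none (y , x~y , y≢p))

  walk : ℕ → Vertex
  walk zero          = b
  walk (suc zero)    = b′
  walk (suc (suc k)) = otherNeighbour (walk (suc k)) (walk k)

  Fresh : ℕ → Set
  Fresh k = ∀ {p q} → p ≤ k → q ≤ k → walk p ≡ walk q → p ≡ q

  module _ {k} (fresh : Fresh k) where

    walk-≢-b : ∀ m → suc m ≤ k → walk (suc m) ≢ b
    walk-≢-b m 1+m≤k walk≡b with fresh 1+m≤k z≤n walk≡b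
    ... | ()

    walk-adjacent : ∀ m → m ≤ k → Adjacent (walk m) (walk (suc m))
    walk-adjacent zero    _     = b~b′
    walk-adjacent (suc m) 1+m≤k = proj₁ (otherNeighbour-spec (non-b-deg-≥-2 (walk-≢-b m 1+m≤k)))

    walk-no-backtrack : ∀ m → suc m ≤ k → walk (suc (suc m)) ≢ walk m
    walk-no-backtrack m 1+m≤k = proj₂ (otherNeighbour-spec (non-b-deg-≥-2 (walk-≢-b m 1+m≤k)))

    walk-distinct : ∀ {p q} → p ≤ k → q ≤ k → p ≢ q → walk p ≢ walk q
    walk-distinct p≤k q≤k p≢q = p≢q ∘ fresh p≤k q≤k

    -- The walk can neither stay put, nor backtrack, nor come back to the pendant vertex b.
    repeat-closes-lasso : ∀ {j} → j ≤ k → walk (suc k) ≡ walk j → ∃ λ j′ → j ≡ suc j′ × suc (suc (suc j′)) ≤ k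
    repeat-closes-lasso j≤k repeat with ≤-cases j≤k
    ... | inj₁ refl        = ⊥-elim (adjacent-irrefl (walk-adjacent k ℕₚ.≤-refl) (sym repeat))
    ... | inj₂ (inj₁ refl) = ⊥-elim (walk-no-backtrack _ ℕₚ.≤-refl repeat)
    repeat-closes-lasso {suc j′} _ _ | inj₂ (inj₂ 3+j′≤k) = j′ , refl , 3+j′≤k
    repeat-closes-lasso {zero}  _ repeat | inj₂ (inj₂ 2≤k) =
      ⊥-elim (ℕₚ.<⇒≢ (ℕₚ.≤-trans (s≤s (s≤s z≤n)) 2≤k)
                     (sym (fresh ℕₚ.≤-refl (ℕₚ.≤-trans (s≤s z≤n) 2≤k) walk-k≡b′)))
      where
      walk-k≡b′ : walk k ≡ b′
      walk-k≡b′ = unique-neighbour b-pendant b~b′ (adjacent-sym (subst (Adjacent (walk k)) repeat (walk-adjacent k ℕₚ.≤-refl)))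

  module Lasso {k} (j′ : ℕ) (fresh : Fresh k) (3+j′≤k : suc (suc (suc j′)) ≤ k) (closes : walk (suc k) ≡ walk (suc j′)) where

    j : ℕ
    j = suc j′

    1+j≤k : suc j ≤ k
    1+j≤k = ℕₚ.<⇒≤ 3+j′≤k

    j≤k : j ≤ k
    j≤k = ℕₚ.<⇒≤ 1+j≤k

    j′≤k : j′ ≤ k
    j′≤k = ℕₚ.<⇒≤ j≤k

    k~j : Adjacent (walk k) (walk j)
    k~j = subst (Adjacent (walk k)) closes (walk-adjacent fresh k ℕₚ.≤-refl)

    j-neighbours-unique : Unique (walk j′ ∷ walk (suc j) ∷ walk k ∷ [])
    j-neighbours-unique =
      (walk-distinct fresh j′≤k 1+j≤k (ℕₚ.<⇒≢ (ℕₚ.n≤1+n (suc j′))) ∷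
       walk-distinct fresh j′≤k ℕₚ.≤-refl (ℕₚ.<⇒≢ (ℕₚ.<-trans (ℕₚ.n<1+n j′) (ℕₚ.<-trans (ℕₚ.n<1+n j) 3+j′≤k))) ∷ []) ∷
      (walk-distinct fresh 1+j≤k ℕₚ.≤-refl (ℕₚ.<⇒≢ 3+j′≤k) ∷ []) ∷ [] ∷ []

    j-neighbours-adjacent : All (Adjacent (walk j)) (walk j′ ∷ walk (suc j) ∷ walk k ∷ [])
    j-neighbours-adjacent = adjacent-sym (walk-adjacent fresh j′ j′≤k) ∷ walk-adjacent fresh j j≤k ∷ adjacent-sym k~j ∷ []

    deg-j≡3 : deg G (walk j) ≡ 3
    deg-j≡3 with deg-2-or-3 (walk j) (walk-≢-b fresh j′ j≤k)
    ... | inj₂ deg≡3 = deg≡3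
    ... | inj₁ deg≡2 = ⊥-elim (ℕₚ.<⇒≱ (deg-≥-length j-neighbours-unique j-neighbours-adjacent) (ℕₚ.≤-reflexive deg≡2))

    deg≡2 : ∀ m → suc m ≤ k → suc m ≢ j → deg G (walk (suc m)) ≡ 2
    deg≡2 m 1+m≤k 1+m≢j with deg-2-or-3 (walk (suc m)) (walk-≢-b fresh m 1+m≤k)
    ... | inj₁ deg≡2 = deg≡2
    ... | inj₂ deg≡3 = ⊥-elim (1+m≢j (fresh 1+m≤k j≤k
                          (deg-≥3-unique (ℕₚ.≤-reflexive (sym deg≡3)) (ℕₚ.≤-reflexive (sym deg-j≡3)))))

    -- The walk up to step k is the path 0 — 1 — ⋯ — k with the chord {k, j}, and no other edges leave it.
    neighbours : ∀ {m y} → m ≤ k → Adjacent (walk m) y → ∃ λ q → q ≤ k × y ≡ walk q × Chorded k j m q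
    neighbours {zero} _ b~y = 1 , ℕₚ.≤-trans (s≤s z≤n) j≤k , unique-neighbour b-pendant b~b′ b~y , step
    neighbours {suc m} 1+m≤k m~y with suc m ℕₚ.≟ j
    ... | yes refl with neighbour-∈ j-neighbours-unique j-neighbours-adjacent deg-j≡3 m~y
    ...   | here y≡                 = j′    , j′≤k      , y≡ , step⁻
    ...   | there (here y≡)         = suc j , 1+j≤k     , y≡ , step
    ...   | there (there (here y≡)) = k     , ℕₚ.≤-refl , y≡ , chord⁻
    neighbours {suc m} 1+m≤k m~y | no 1+m≢j with ℕₚ.m≤n⇒m<n∨m≡n 1+m≤k
    ... | inj₁ 2+m≤k with neighbour-of-two (deg≡2 m 1+m≤k 1+m≢j) (adjacent-sym (walk-adjacent fresh m (ℕₚ.<⇒≤ 1+m≤k)))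
                            (walk-adjacent fresh (suc m) 1+m≤k)
                            (walk-distinct fresh (ℕₚ.<⇒≤ 1+m≤k) 2+m≤k (ℕₚ.<⇒≢ (ℕₚ.n≤1+n (suc m)))) m~y
    ...   | inj₁ y≡ = m           , ℕₚ.<⇒≤ 1+m≤k , y≡ , step⁻
    ...   | inj₂ y≡ = suc (suc m) , 2+m≤k        , y≡ , step
    neighbours {suc m} 1+m≤k m~y | no 1+m≢j | inj₂ refl with neighbour-of-two (deg≡2 m 1+m≤k 1+m≢j)
                            (adjacent-sym (walk-adjacent fresh m (ℕₚ.n≤1+n m))) k~j
                            (walk-distinct fresh (ℕₚ.n≤1+n m) j≤k (λ m≡j → ℕₚ.<⇒≱ 3+j′≤k (ℕₚ.≤-reflexive (cong suc m≡j)))) m~y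
    ...   | inj₁ y≡ = m , ℕₚ.n≤1+n m , y≡ , step⁻
    ...   | inj₂ y≡ = j , j≤k        , y≡ , chord

    covers : ∀ x → ∃ λ q → q ≤ k × x ≡ walk q
    covers x = reach-closed S closed (0 , z≤n , refl) (conn b x)
      where
      S : Vertex → Set
      S x = ∃ λ q → q ≤ k × x ≡ walk q
      closed : ∀ {x y} → S x → Adjacent x y → S y
      closed (q , q≤k , refl) x~y with neighbours q≤k x~y
      ... | q′ , q′≤k , y≡ , _ = q′ , q′≤k , y≡

    adjacent⇒Chorded : ∀ {p q} → p ≤ k → q ≤ k → Adjacent (walk p) (walk q) → Chorded k j p q
    adjacent⇒Chorded p≤k q≤k p~q with neighbours p≤k p~q
    ... | q′ , q′≤k , walk-q≡ , e = subst (Chorded k j _) (sym (fresh q≤k q′≤k walk-q≡)) e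

    Chorded⇒adjacent : ∀ {p q} → p ≤ k → q ≤ k → Chorded k j p q → Adjacent (walk p) (walk q)
    Chorded⇒adjacent p≤k _   step   = walk-adjacent fresh _ p≤k
    Chorded⇒adjacent _   q≤k step⁻  = adjacent-sym (walk-adjacent fresh _ q≤k)
    Chorded⇒adjacent _   _   chord  = k~j
    Chorded⇒adjacent _   _   chord⁻ = adjacent-sym k~j

  covered-vertices-≤ : ∀ {k} → (∀ x → ∃ λ q → q ≤ k × x ≡ walk q) → V G ≤ suc k
  covered-vertices-≤ {k} covered with V G ℕₚ.≤? suc k
  ... | yes V≤1+k = V≤1+k
  ... | no  V≰1+k with Finₚ.pigeonhole (ℕₚ.≰⇒> V≰1+k) (λ x → fromℕ< (s≤s (proj₁ (proj₂ (covered x)))))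
  ...   | x , y , x<y , same = ⊥-elim (Finₚ.<⇒≢ x<y (trans (proj₂ (proj₂ (covered x)))
                                      (trans (cong walk (Finₚ.fromℕ<-injective _ _ _ _ same)) (sym (proj₂ (proj₂ (covered y)))))))

  no-early-repeat : ∀ {k j} → Fresh k → suc k < V G → j ≤ k → walk (suc k) ≢ walk j
  no-early-repeat fresh 1+k<V j≤k repeat with repeat-closes-lasso fresh j≤k repeat
  ... | j′ , refl , 3+j′≤k = ℕₚ.<⇒≱ 1+k<V (covered-vertices-≤ (Lasso.covers j′ fresh 3+j′≤k repeat))

  fresh-step : ∀ {k} → Fresh k → suc k < V G → Fresh (suc k)
  fresh-step fresh 1+k<V p≤1+k q≤1+k same with ℕₚ.m≤n⇒m<n∨m≡n p≤1+k | ℕₚ.m≤n⇒m<n∨m≡n q≤1+k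
  ... | inj₁ p<1+k | inj₁ q<1+k = fresh (ℕₚ.≤-pred p<1+k) (ℕₚ.≤-pred q<1+k) same
  ... | inj₂ refl  | inj₂ refl  = refl
  ... | inj₂ refl  | inj₁ q<1+k = ⊥-elim (no-early-repeat fresh 1+k<V (ℕₚ.≤-pred q<1+k) same)
  ... | inj₁ p<1+k | inj₂ refl  = ⊥-elim (no-early-repeat fresh 1+k<V (ℕₚ.≤-pred p<1+k) (sym same))

  fresh-N : Fresh N
  fresh-N = fresh-≤ N ℕₚ.≤-refl
    where
    fresh-≤ : ∀ k → k ≤ N → Fresh k
    fresh-≤ zero    _     p≤0 q≤0 _ = trans (ℕₚ.n≤0⇒n≡0 p≤0) (sym (ℕₚ.n≤0⇒n≡0 q≤0))
    fresh-≤ (suc k) 1+k≤N = fresh-step (fresh-≤ k (ℕₚ.<⇒≤ 1+k≤N)) (subst (suc k <_) (sym V≡1+N) (s≤s 1+k≤N))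

  -- By pigeonhole the first N + 2 steps repeat, and only the last step can.
  closing : ∃ λ j′ → suc (suc (suc j′)) ≤ N × walk (suc N) ≡ walk (suc j′)
  closing with Finₚ.pigeonhole (subst (_< suc (suc N)) (sym V≡1+N) ℕₚ.≤-refl) (λ (t : Fin (suc (suc N))) → walk (toℕ t))
  ... | s , t , s<t , same with ℕₚ.m≤n⇒m<n∨m≡n (ℕₚ.≤-pred (Finₚ.toℕ<n t))
  ...   | inj₁ t≤N = ⊥-elim (Finₚ.<⇒≢ s<t (Finₚ.toℕ-injective
                         (fresh-N (ℕₚ.<⇒≤ (ℕₚ.<-≤-trans s<t (ℕₚ.≤-pred t≤N))) (ℕₚ.≤-pred t≤N) same)))
  ...   | inj₂ t≡1+N with repeat-closes-lasso fresh-N (ℕₚ.≤-pred (subst (toℕ s <_) t≡1+N s<t))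
                                               (trans (cong walk (sym t≡1+N)) (sym same))
  ...     | j′ , s≡1+j′ , 3+j′≤N = j′ , 3+j′≤N , trans (cong walk (sym t≡1+N)) (trans (sym same) (cong walk s≡1+j′))

  module Closed = Lasso (proj₁ closing) fresh-N (proj₁ (proj₂ closing)) (proj₂ (proj₂ closing))
  open Closed using (j)

  position : Vertex → ℕ
  position x = proj₁ (Closed.covers x)

  position≤N : ∀ x → position x ≤ N
  position≤N x = proj₁ (proj₂ (Closed.covers x))

  walk-position : ∀ x → x ≡ walk (position x)
  walk-position x = proj₂ (proj₂ (Closed.covers x))

  position-walk : ∀ {q} → q ≤ N → position (walk q) ≡ q
  position-walk {q} q≤N = fresh-N (position≤N (walk q)) q≤N (sym (walk-position (walk q)))

  -- The walk runs t_n, t_{n-1}, …, t_1, so step q of the walk is tadpole index N ∸ q.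
  tadpoleIndex : Vertex → Fin (suc N)
  tadpoleIndex x = fromℕ< (index<1+N x)
    where
    index<1+N : ∀ x → N ∸ position x < suc N
    index<1+N x = s≤s (ℕₚ.m∸n≤m N (position x))

  toℕ-tadpoleIndex : ∀ x → toℕ (tadpoleIndex x) ≡ N ∸ position x
  toℕ-tadpoleIndex x = Finₚ.toℕ-fromℕ< (s≤s (ℕₚ.m∸n≤m N (position x)))

  σ : Vertex ↔ Fin (suc N)
  σ = mk↔ₛ′ tadpoleIndex (λ t → walk (N ∸ toℕ t)) index-walk walk-index
    where
    index-walk : ∀ t → tadpoleIndex (walk (N ∸ toℕ t)) ≡ t
    index-walk t = Finₚ.toℕ-injective (begin
      toℕ (tadpoleIndex (walk (N ∸ toℕ t))) ≡⟨ toℕ-tadpoleIndex (walk (N ∸ toℕ t)) ⟩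
      N ∸ position (walk (N ∸ toℕ t))       ≡⟨ cong (N ∸_) (position-walk (ℕₚ.m∸n≤m N (toℕ t))) ⟩
      N ∸ (N ∸ toℕ t)                       ≡⟨ ℕₚ.m∸[m∸n]≡n (ℕₚ.≤-pred (Finₚ.toℕ<n t)) ⟩
      toℕ t                                 ∎)
      where open ≡-Reasoning
    walk-index : ∀ x → walk (N ∸ toℕ (tadpoleIndex x)) ≡ x
    walk-index x = begin
      walk (N ∸ toℕ (tadpoleIndex x)) ≡⟨ cong (λ a → walk (N ∸ a)) (toℕ-tadpoleIndex x) ⟩
      walk (N ∸ (N ∸ position x))     ≡⟨ cong walk (ℕₚ.m∸[m∸n]≡n (position≤N x)) ⟩
      walk (position x)               ≡⟨ walk-position x ⟨
      x                               ∎
      where open ≡-Reasoning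

  i : ℕ
  i = suc (N ∸ j)

  walk-adjacent⇔tadpole : ∀ {p q} → p ≤ N → q ≤ N → Adjacent (walk p) (walk q) ⇔ T (tadAdjℕ i (N ∸ p) (N ∸ q))
  walk-adjacent⇔tadpole {p} {q} p≤N q≤N = mk⇔
    (λ p~q → Chorded⇒tadAdjℕ {i} (subst (λ u → Chorded u (N ∸ j) (N ∸ p) (N ∸ q)) (ℕₚ.n∸n≡0 N)
                                   (Chorded-reflect p≤N q≤N (Closed.adjacent⇒Chorded p≤N q≤N p~q))))
    (λ t → Closed.Chorded⇒adjacent p≤N q≤N
             (Chorded-unreflect ℕₚ.≤-refl Closed.j≤k p≤N q≤N
               (subst (λ u → Chorded u (N ∸ j) (N ∸ p) (N ∸ q)) (sym (ℕₚ.n∸n≡0 N)) (tadAdjℕ⇒Chorded i (N ∸ p) (N ∸ q) t))))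

  σ-adj : ∀ x y → adj G x y ≡ tadAdj (suc N) i (Inverse.to σ x) (Inverse.to σ y)
  σ-adj x y = begin
    adj G x y                                      ≡⟨ cong₂ (adj G) (walk-position x) (walk-position y) ⟩
    adj G (walk (position x)) (walk (position y))  ≡⟨ T-injective (walk-adjacent⇔tadpole (position≤N x) (position≤N y)) ⟩
    tadAdjℕ i (N ∸ position x) (N ∸ position y)    ≡⟨ cong₂ (tadAdjℕ i) (toℕ-tadpoleIndex x) (toℕ-tadpoleIndex y) ⟨
    tadAdj (suc N) i (tadpoleIndex x) (tadpoleIndex y) ∎
    where open ≡-Reasoning

  3≤i : 3 ≤ i
  3≤i = s≤s (subst (_≤ N ∸ j) (ℕₚ.m+n∸n≡m 2 j) (ℕₚ.∸-monoˡ-≤ j (proj₁ (proj₂ closing))))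

  i<1+N : i < suc N
  i<1+N = s≤s (m∸1+n<m (proj₁ closing) (ℕₚ.≤-trans (s≤s z≤n) 3≤N))

  recognised : ∃ λ i → 3 ≤ i × i < suc N × IsoTadpole G (suc N) i
  recognised = i , 3≤i , i<1+N , σ , σ-adj

module FiniteMinimum {A : Set} (xs : List A) (complete : ∀ a → a ∈ xs) where
  open import Data.List using (filter)
  open import Data.List.Extrema (DecTotalOrder.totalOrder ℚₚ.≤-decTotalOrder) using (argmin; argmin-sel; f[argmin]≤f[xs])
  open import Data.List.Membership.Propositional.Properties using (∈-filter⁺; ∈-filter⁻)
  import Data.List.Relation.Unary.All as All

  minimum : ∀ {P : A → Set} → Decidable P → (c : A → ℚ) → ∃ P → ∃ λ a → P a × (∀ b → P b → c a ≤ℚ c b)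
  minimum {P} P? c (a₀ , Pa₀) = m , Pm , m-least
    where
    candidates : List A
    candidates = filter P? xs
    m : A
    m = argmin c a₀ candidates
    Pm : P m
    Pm with argmin-sel c a₀ candidates
    ... | inj₁ m≡a₀ = subst P (sym m≡a₀) Pa₀
    ... | inj₂ m∈   = proj₂ (∈-filter⁻ P? {xs = xs} m∈)
    m-least : ∀ b → P b → c m ≤ℚ c b
    m-least b Pb = All.lookup (f[argmin]≤f[xs] a₀ candidates) (∈-filter⁺ P? (complete b) Pb)

module BoolVectors where
  open import Data.List using (_++_)
  open import Data.List.Membership.Propositional.Properties using (∈-++⁺ˡ; ∈-++⁺ʳ; ∈-map⁺)

  allBoolVecs : ∀ k → List (Vec Bool k)
  allBoolVecs zero    = [] ∷ []
  allBoolVecs (suc k) = map (true ∷_) (allBoolVecs k) ++ map (false ∷_) (allBoolVecs k)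

  ∈-allBoolVecs : ∀ {k} (v : Vec Bool k) → v ∈ allBoolVecs k
  ∈-allBoolVecs []          = here refl
  ∈-allBoolVecs (true ∷ v)  = ∈-++⁺ˡ (∈-map⁺ (true ∷_) (∈-allBoolVecs v))
  ∈-allBoolVecs (false ∷ v) = ∈-++⁺ʳ (map (true ∷_) (allBoolVecs _)) (∈-map⁺ (false ∷_) (∈-allBoolVecs v))

module Rationals where
  open import Data.Rational using (0ℚ; _+_; _-_; _*_; -_; ∣_∣; mkℚ)
  import Data.Integer as ℤ
  import Data.Integer.Properties as ℤₚ
  open import Data.Nat.Coprimality using (1-coprimeTo)
  import Data.Nat.Coprimality as Coprime
  open import Data.Rational.Solver using (module +-*-Solver)
  open +-*-Solver using (solve; con; _:+_; _:-_; _:*_; :-_; _:=_)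
  open import Algebra.Bundles using (CommutativeMonoid)
  open import Algebra.Properties.CommutativeSemigroup (CommutativeMonoid.commutativeSemigroup ℚₚ.+-0-commutativeMonoid)
    using (interchange)

  toℚ : ℕ → ℚ
  toℚ m = ℤ.+ m / 1

  private
    toℚ-mkℚ : ∀ m → toℚ m ≡ mkℚ (ℤ.+ m) 0 (Coprime.sym (1-coprimeTo m))
    toℚ-mkℚ m = ℚₚ.normalize-coprime (Coprime.sym (1-coprimeTo m))

  toℚ-+ : ∀ m k → toℚ (m ℕ.+ k) ≡ toℚ m + toℚ k
  toℚ-+ m k rewrite toℚ-mkℚ m | toℚ-mkℚ k =
    cong (_/ 1) (sym (cong₂ ℤ._+_ (ℤₚ.*-identityʳ (ℤ.+ m)) (ℤₚ.*-identityʳ (ℤ.+ k))))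

  toℚ-* : ∀ m k → toℚ (m ℕ.* k) ≡ toℚ m * toℚ k
  toℚ-* m k rewrite toℚ-mkℚ m | toℚ-mkℚ k = cong (_/ 1) (ℤₚ.pos-* m k)

  toℚ-mono-≤ : ∀ {m k} → m ≤ k → toℚ m ≤ℚ toℚ k
  toℚ-mono-≤ {m} {k} m≤k rewrite toℚ-mkℚ m | toℚ-mkℚ k =
    ℚ.*≤* (subst₂ ℤ._≤_ (sym (ℤₚ.*-identityʳ (ℤ.+ m))) (sym (ℤₚ.*-identityʳ (ℤ.+ k))) (ℤ.+≤+ m≤k))

  toℚ-injective : ∀ {m k} → toℚ m ≡ toℚ k → m ≡ k
  toℚ-injective {m} {k} eq rewrite toℚ-mkℚ m | toℚ-mkℚ k = ℤₚ.+-injective (cong ℚ.↥_ eq)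

  toℚ-nonNeg : ∀ m → 0ℚ ≤ℚ toℚ m
  toℚ-nonNeg m = toℚ-mono-≤ {0} {m} z≤n

  -- recip 0 = 0 is a junk value; it is only ever multiplied by toℚ 0.
  recip : ℕ → ℚ
  recip zero    = 0ℚ
  recip (suc k) = ℤ.+ 1 / suc k

  recip-inverseˡ : ∀ k → recip (suc k) * toℚ (suc k) ≡ 1ℚ
  recip-inverseˡ k rewrite toℚ-mkℚ (suc k) | ℚₚ.normalize-coprime {1} {k} (1-coprimeTo (suc k)) =
    ℚₚ.*-inverseˡ (mkℚ (ℤ.+ suc k) 0 (Coprime.sym (1-coprimeTo (suc k))))

  recip-nonNeg : ∀ k → 0ℚ ≤ℚ recip k
  recip-nonNeg zero    = ℚₚ.≤-refl
  recip-nonNeg (suc k) = ℚₚ.nonNegative⁻¹ (recip (suc k)) {{ℚₚ.normalize-nonNeg 1 (suc k)}}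

  *-recip-cancelʳ : ∀ p k → p * recip (suc k) * toℚ (suc k) ≡ p
  *-recip-cancelʳ p k = trans (ℚₚ.*-assoc p _ _) (trans (cong (p *_) (recip-inverseˡ k)) (ℚₚ.*-identityʳ p))

  *-monoʳ-≤-nonNeg : ∀ {m p q} → 0ℚ ≤ℚ m → p ≤ℚ q → p * m ≤ℚ q * m
  *-monoʳ-≤-nonNeg {m} 0≤m = ℚₚ.*-monoʳ-≤-nonNeg m {{ℚ.nonNegative 0≤m}}

  *-monoˡ-≤-nonNeg : ∀ {m p q} → 0ℚ ≤ℚ m → p ≤ℚ q → m * p ≤ℚ m * q
  *-monoˡ-≤-nonNeg {m} 0≤m = ℚₚ.*-monoˡ-≤-nonNeg m {{ℚ.nonNegative 0≤m}}

  private
    -- ∣ p ∣ = ∣ (p - q) + q ∣ ≤ ∣ p - q ∣ + ∣ q ∣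
    ∣p∣-∣q∣≤∣p-q∣ : ∀ p q → ∣ p ∣ - ∣ q ∣ ≤ℚ ∣ p - q ∣
    ∣p∣-∣q∣≤∣p-q∣ p q = subst₂ _≤ℚ_ (cong (λ r → ∣ r ∣ - ∣ q ∣) (solve 2 (λ p q → (p :- q) :+ q := p) refl p q))
                                    (solve 2 (λ a b → (a :+ b) :- b := a) refl ∣ p - q ∣ ∣ q ∣)
                                    (ℚₚ.+-monoˡ-≤ (- ∣ q ∣) (ℚₚ.∣p+q∣≤∣p∣+∣q∣ (p - q) q))

  ∣∣p∣-∣q∣∣≤∣p-q∣ : ∀ p q → ∣ ∣ p ∣ - ∣ q ∣ ∣ ≤ℚ ∣ p - q ∣
  ∣∣p∣-∣q∣∣≤∣p-q∣ p q with ℚₚ.∣p∣≡p∨∣p∣≡-p (∣ p ∣ - ∣ q ∣)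
  ... | inj₁ eq = subst (_≤ℚ ∣ p - q ∣) (sym eq) (∣p∣-∣q∣≤∣p-q∣ p q)
  ... | inj₂ eq = subst₂ _≤ℚ_ (trans (solve 2 (λ a b → b :- a := :- (a :- b)) refl ∣ p ∣ ∣ q ∣) (sym eq))
                              (trans (cong ∣_∣ (solve 2 (λ p q → q :- p := :- (p :- q)) refl p q)) (ℚₚ.∣-p∣≡∣p∣ (p - q)))
                              (∣p∣-∣q∣≤∣p-q∣ q p)

  0-p*0≡0 : ∀ p → 0ℚ - p * 0ℚ ≡ 0ℚ
  0-p*0≡0 = solve 1 (λ p → con 0ℚ :- p :* con 0ℚ := con 0ℚ) refl

  l*[m*c+r]≡m*[l*c]+l*r : ∀ l m c r → l * (m * c + r) ≡ m * (l * c) + l * r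
  l*[m*c+r]≡m*[l*c]+l*r = solve 4 (λ l m c r → l :* (m :* c :+ r) := m :* (l :* c) :+ l :* r) refl

  p≤q⇒0≤q-p : ∀ {p q} → p ≤ℚ q → 0ℚ ≤ℚ q - p
  p≤q⇒0≤q-p {p} {q} p≤q = subst (_≤ℚ q - p) (ℚₚ.+-inverseʳ p) (ℚₚ.+-monoˡ-≤ (- p) p≤q)

  ∣p-q∣≡∣q-p∣ : ∀ p q → ∣ p - q ∣ ≡ ∣ q - p ∣
  ∣p-q∣≡∣q-p∣ p q = trans (cong ∣_∣ (solve 2 (λ p q → p :- q := :- (q :- p)) refl p q)) (ℚₚ.∣-p∣≡∣p∣ (q - p))

  sumℚ-cong : ∀ {k} {f g : Fin k → ℚ} → (∀ i → f i ≡ g i) → sumℚ f ≡ sumℚ g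
  sumℚ-cong {zero}  f≗g = refl
  sumℚ-cong {suc k} f≗g = cong₂ _+_ (f≗g zero) (sumℚ-cong (λ i → f≗g (suc i)))

  sumℚ-+ : ∀ {k} (f g : Fin k → ℚ) → sumℚ (λ i → f i + g i) ≡ sumℚ f + sumℚ g
  sumℚ-+ {zero}  f g = sym (ℚₚ.+-identityˡ 0ℚ)
  sumℚ-+ {suc k} f g = trans (cong (f zero + g zero +_) (sumℚ-+ (f ∘ suc) (g ∘ suc)))
                             (interchange (f zero) (g zero) (sumℚ (f ∘ suc)) (sumℚ (g ∘ suc)))

  sumℚ-*ˡ : ∀ {k} c (f : Fin k → ℚ) → sumℚ (λ i → c * f i) ≡ c * sumℚ f
  sumℚ-*ˡ {zero}  c f = sym (ℚₚ.*-zeroʳ c)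
  sumℚ-*ˡ {suc k} c f = trans (cong (c * f zero +_) (sumℚ-*ˡ c (λ i → f (suc i)))) (sym (ℚₚ.*-distribˡ-+ c (f zero) _))

  sumℚ-mono-≤ : ∀ {k} {f g : Fin k → ℚ} → (∀ i → f i ≤ℚ g i) → sumℚ f ≤ℚ sumℚ g
  sumℚ-mono-≤ {zero}  f≤g = ℚₚ.≤-refl
  sumℚ-mono-≤ {suc k} f≤g = ℚₚ.+-mono-≤ (f≤g zero) (sumℚ-mono-≤ (λ i → f≤g (suc i)))

  sumℚ-toℚ : ∀ {k} (h : Fin k → ℕ) → sumℚ (λ i → toℚ (h i)) ≡ toℚ (sumℕ h)
  sumℚ-toℚ {zero}  h = refl
  sumℚ-toℚ {suc k} h = trans (cong (toℚ (h zero) +_) (sumℚ-toℚ (λ i → h (suc i)))) (sym (toℚ-+ (h zero) _))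

  sumℚ-zeros : ∀ k → sumℚ {k} (λ _ → 0ℚ) ≡ 0ℚ
  sumℚ-zeros zero    = refl
  sumℚ-zeros (suc k) = trans (ℚₚ.+-identityˡ (sumℚ {k} (λ _ → 0ℚ))) (sumℚ-zeros k)

  sumℚ-nonNeg : ∀ {k} {f : Fin k → ℚ} → (∀ i → 0ℚ ≤ℚ f i) → 0ℚ ≤ℚ sumℚ f
  sumℚ-nonNeg {k} {f} 0≤f = subst (_≤ℚ sumℚ f) (sumℚ-zeros k) (sumℚ-mono-≤ 0≤f)

module Coarea (G : Graph) where
  open import Data.Rational using (0ℚ; _+_; _-_; _*_; ∣_∣)
  open Arithmetic using (if-mono; false≢true)
  open import Data.Rational.Solver using (module +-*-Solver)
  open +-*-Solver using (solve; con; _:+_; _:-_; _:*_; _:=_)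
  open FinSum
  open GraphCounting G
  open Rationals

  χ : (Vertex → Bool) → Vertex → ℚ
  χ U x = if U x then 1ℚ else 0ℚ

  χ-zero : ∀ {U x} → U x ≡ false → χ U x ≡ 0ℚ
  χ-zero {U} {x} Ux = cong (λ b → if b then 1ℚ else 0ℚ) Ux

  χ-nonzero : ∀ {U x} → U x ≡ true → χ U x ≢ 0ℚ
  χ-nonzero {U} {x} Ux χ≡0 with trans (sym (cong (λ b → if b then 1ℚ else 0ℚ) Ux)) χ≡0
  ... | ()

  sumℚ-χ : ∀ U → sumℚ (χ U) ≡ toℚ (card U)
  sumℚ-χ U = trans (sumℚ-cong pointwise) (sumℚ-toℚ (λ x → if U x then 1 else 0))
    where
    pointwise : ∀ x → χ U x ≡ toℚ (if U x then 1 else 0)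
    pointwise x with U x
    ... | true  = refl
    ... | false = refl

  mass-χ : ∀ U → mass G (χ U) ≡ toℚ (card U)
  mass-χ U = trans (sumℚ-cong (λ x → ℚₚ.0≤p⇒∣p∣≡p (χ-nonNeg x))) (sumℚ-χ U)
    where
    χ-nonNeg : ∀ x → 0ℚ ≤ℚ χ U x
    χ-nonNeg x with U x
    ... | true  = toℚ-nonNeg 1
    ... | false = ℚₚ.≤-refl

  edgeVariation-χ : ∀ U → edgeVariation G (χ U) ≡ toℚ (cut U)
  edgeVariation-χ U = trans (sumℚ-cong (λ x → trans (sumℚ-cong (pointwise x)) (sumℚ-toℚ (cutEdge x))))
                            (sumℚ-toℚ (λ x → sumℕ (cutEdge x)))
    where
    cutEdge : Vertex → Vertex → ℕ
    cutEdge x y = ind ((U x xor U y) ∧ edge? x y)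
    pointwise : ∀ x y → (if edge? x y then ∣ χ U x - χ U y ∣ else 0ℚ) ≡ toℚ (cutEdge x y)
    pointwise x y with edge? x y | U x | U y
    ... | false | true  | true  = refl
    ... | false | true  | false = refl
    ... | false | false | true  = refl
    ... | false | false | false = refl
    ... | true  | true  | true  = refl
    ... | true  | true  | false = refl
    ... | true  | false | true  = refl
    ... | true  | false | false = refl

  edgeVariation-nonNeg : ∀ g → 0ℚ ≤ℚ edgeVariation G g
  edgeVariation-nonNeg g = sumℚ-nonNeg (λ x → sumℚ-nonNeg (λ y → pointwise x y))
    where
    pointwise : ∀ x y → 0ℚ ≤ℚ (if edge? x y then ∣ g x - g y ∣ else 0ℚ)
    pointwise x y with edge? x y
    ... | true  = ℚₚ.0≤∣p∣ (g x - g y)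
    ... | false = ℚₚ.≤-refl

  edgeVariation-split : ∀ m (h₁ h₂ g : Vertex → ℚ) → (∀ x y → ∣ g x - g y ∣ ≡ m * ∣ h₁ x - h₁ y ∣ + ∣ h₂ x - h₂ y ∣) →
                        edgeVariation G g ≡ m * edgeVariation G h₁ + edgeVariation G h₂
  edgeVariation-split m h₁ h₂ g split =
    trans (sumℚ-cong (λ x → trans (sumℚ-cong (pointwise x))
                              (trans (sumℚ-+ (λ y → m * term h₁ x y) (term h₂ x)) (cong (_+ sumℚ (term h₂ x)) (sumℚ-*ˡ m (term h₁ x))))))
          (trans (sumℚ-+ (λ x → m * sumℚ (term h₁ x)) (λ x → sumℚ (term h₂ x)))
                 (cong (_+ edgeVariation G h₂) (sumℚ-*ˡ m (λ x → sumℚ (term h₁ x)))))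
    where
    term : (Vertex → ℚ) → Vertex → Vertex → ℚ
    term h x y = if edge? x y then ∣ h x - h y ∣ else 0ℚ
    pointwise : ∀ x y → term g x y ≡ m * term h₁ x y + term h₂ x y
    pointwise x y with edge? x y
    ... | true  = split x y
    ... | false = sym (trans (ℚₚ.+-identityʳ (m * 0ℚ)) (ℚₚ.*-zeroʳ m))

  -- The pairs (g x, χ_U x) for g ≥ 0 with support U and least positive value m.
  data Layer (m : ℚ) : ℚ → ℚ → Set where
    outside : Layer m 0ℚ 0ℚ
    inside  : ∀ {a} → m ≤ℚ a → Layer m a 1ℚ

  private
    layer-split-inside-outside : ∀ {m a} → 0ℚ ≤ℚ m → m ≤ℚ a →
                                 ∣ a - 0ℚ ∣ ≡ m * ∣ 1ℚ - 0ℚ ∣ + ∣ (a - m * 1ℚ) - (0ℚ - m * 0ℚ) ∣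
    layer-split-inside-outside {m} {a} 0≤m m≤a = begin
      ∣ a - 0ℚ ∣                                  ≡⟨ cong ∣_∣ (solve 1 (λ a → a :- con 0ℚ := a) refl a) ⟩
      ∣ a ∣                                       ≡⟨ ℚₚ.0≤p⇒∣p∣≡p (ℚₚ.≤-trans 0≤m m≤a) ⟩
      a                                           ≡⟨ solve 2 (λ m a → a := m :* con 1ℚ :+ (a :- m)) refl m a ⟩
      m * 1ℚ + (a - m)                            ≡⟨ cong (m * 1ℚ +_) (ℚₚ.0≤p⇒∣p∣≡p (p≤q⇒0≤q-p m≤a)) ⟨
      m * 1ℚ + ∣ a - m ∣                          ≡⟨ cong (λ r → m * 1ℚ + ∣ r ∣)
                                                       (solve 2 (λ m a → a :- m := (a :- m :* con 1ℚ) :- (con 0ℚ :- m :* con 0ℚ)) refl m a) ⟩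
      m * ∣ 1ℚ - 0ℚ ∣ + ∣ (a - m * 1ℚ) - (0ℚ - m * 0ℚ) ∣ ∎
      where open ≡-Reasoning

  -- Both values are 0 or at least m, so removing the layer of height m never changes the sign of a difference.
  layer-split : ∀ {m a a′ c c′} → 0ℚ ≤ℚ m → Layer m a c → Layer m a′ c′ →
                ∣ a - a′ ∣ ≡ m * ∣ c - c′ ∣ + ∣ (a - m * c) - (a′ - m * c′) ∣
  layer-split {m} 0≤m outside outside =
    sym (trans (cong (λ r → m * 0ℚ + ∣ r - r ∣) (0-p*0≡0 m)) (trans (ℚₚ.+-identityʳ (m * 0ℚ)) (ℚₚ.*-zeroʳ m)))
  layer-split {m} {a} {a′} 0≤m (inside _) (inside _) =
    sym (trans (cong (m * 0ℚ +_) (cong ∣_∣ (solve 3 (λ m a a′ → (a :- m :* con 1ℚ) :- (a′ :- m :* con 1ℚ) := a :- a′) refl m a a′)))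
               (trans (cong (_+ ∣ a - a′ ∣) (ℚₚ.*-zeroʳ m)) (ℚₚ.+-identityˡ _)))
  layer-split 0≤m (inside m≤a) outside = layer-split-inside-outside 0≤m m≤a
  layer-split {m} {a′ = a′} 0≤m outside (inside m≤a′) = begin
    ∣ 0ℚ - a′ ∣                                           ≡⟨ ∣p-q∣≡∣q-p∣ 0ℚ a′ ⟩
    ∣ a′ - 0ℚ ∣                                           ≡⟨ layer-split-inside-outside 0≤m m≤a′ ⟩
    m * ∣ 1ℚ - 0ℚ ∣ + ∣ (a′ - m * 1ℚ) - (0ℚ - m * 0ℚ) ∣   ≡⟨ cong (m * ∣ 1ℚ - 0ℚ ∣ +_) (∣p-q∣≡∣q-p∣ (a′ - m * 1ℚ) _) ⟩
    m * ∣ 0ℚ - 1ℚ ∣ + ∣ (0ℚ - m * 0ℚ) - (a′ - m * 1ℚ) ∣   ∎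
    where open ≡-Reasoning

  layer-rest-nonNeg : ∀ {m a c} → Layer m a c → 0ℚ ≤ℚ a - m * c
  layer-rest-nonNeg {m} outside = ℚₚ.≤-reflexive (sym (0-p*0≡0 m))
  layer-rest-nonNeg {m} {a} (inside m≤a) =
    subst (0ℚ ≤ℚ_) (solve 2 (λ m a → a :- m := a :- m :* con 1ℚ) refl m a) (p≤q⇒0≤q-p m≤a)

  support : (Vertex → ℚ) → Vertex → Bool
  support g x = not ⌊ g x ℚₚ.≟ 0ℚ ⌋

  support-true : ∀ {g x} → g x ≢ 0ℚ → support g x ≡ true
  support-true {g} {x} gx≢0 with g x ℚₚ.≟ 0ℚ
  ... | yes gx≡0 = ⊥-elim (gx≢0 gx≡0)
  ... | no  _    = refl

  support-false : ∀ {g x} → g x ≡ 0ℚ → support g x ≡ false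
  support-false {g} {x} gx≡0 with g x ℚₚ.≟ 0ℚ
  ... | yes _    = refl
  ... | no gx≢0  = ⊥-elim (gx≢0 gx≡0)

  support-≢0 : ∀ {g x} → support g x ≡ true → g x ≢ 0ℚ
  support-≢0 {g} in-supp gx≡0 = false≢true (trans (sym (support-false {g} gx≡0)) in-supp)

  layer-of : ∀ {m} a → (a ≢ 0ℚ → m ≤ℚ a) → Layer m a (if not ⌊ a ℚₚ.≟ 0ℚ ⌋ then 1ℚ else 0ℚ)
  layer-of a least with a ℚₚ.≟ 0ℚ
  ... | yes refl = outside
  ... | no  a≢0  = inside (least a≢0)

  zero-or-nonzero : ∀ (g : Vertex → ℚ) → (∀ x → g x ≡ 0ℚ) ⊎ ∃ λ x → g x ≢ 0ℚ
  zero-or-nonzero g with Finₚ.any? (λ x → ¬? (g x ℚₚ.≟ 0ℚ))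
  ... | yes nonzero = inj₂ nonzero
  ... | no  none    = inj₁ (λ x → decidable-stable (g x ℚₚ.≟ 0ℚ) (λ gx≢0 → none (x , gx≢0)))

  module BottomLayer (g : Vertex → ℚ) (g≥0 : ∀ x → 0ℚ ≤ℚ g x) (x₀ : Vertex) (gx₀≢0 : g x₀ ≢ 0ℚ)
                     (least : ∀ x → g x ≢ 0ℚ → g x₀ ≤ℚ g x) where

    m : ℚ
    m = g x₀
    U : Vertex → Bool
    U = support g

    rest : Vertex → ℚ
    rest x = g x - m * χ U x

    layer : ∀ x → Layer m (g x) (χ U x)
    layer x = layer-of (g x) (least x)

    sumℚ-peel : sumℚ g ≡ m * toℚ (card U) + sumℚ rest
    sumℚ-peel = trans (sumℚ-cong (λ x → solve 3 (λ a m c → a := m :* c :+ (a :- m :* c)) refl (g x) m (χ U x)))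
                      (trans (sumℚ-+ (λ x → m * χ U x) rest)
                             (cong (_+ sumℚ rest) (trans (sumℚ-*ˡ m (χ U)) (cong (m *_) (sumℚ-χ U)))))

    edgeVariation-peel : edgeVariation G g ≡ m * toℚ (cut U) + edgeVariation G rest
    edgeVariation-peel = trans (edgeVariation-split m (χ U) rest g (λ x y → layer-split (g≥0 x₀) (layer x) (layer y)))
                               (cong (λ c → m * c + edgeVariation G rest) (edgeVariation-χ U))

    rest-nonNeg : ∀ x → 0ℚ ≤ℚ rest x
    rest-nonNeg x = layer-rest-nonNeg (layer x)

    rest-zero : ∀ {x} → g x ≡ 0ℚ → rest x ≡ 0ℚ
    rest-zero {x} gx≡0 = trans (cong₂ (λ a c → a - m * c) gx≡0 (χ-zero {U} (support-false {g} gx≡0))) (0-p*0≡0 m)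

    U-interior : (∀ x → Boundary G x → g x ≡ 0ℚ) → Interior U
    U-interior g-boundary x Ux x-pendant = false≢true (trans (sym (support-false {g} (g-boundary x x-pendant))) Ux)

    support-shrinks : card (support rest) < card U
    support-shrinks = sumℕ-mono-< shrinks x₀ (subst₂ (λ a c → (if a then 1 else 0) < (if c then 1 else 0))
                                                     (sym (support-false {rest} rest-x₀≡0)) (sym x₀∈U) (s≤s z≤n))
      where
      x₀∈U : U x₀ ≡ true
      x₀∈U = support-true {g} gx₀≢0
      rest-x₀≡0 : rest x₀ ≡ 0ℚ
      rest-x₀≡0 = trans (cong (λ b → m - m * (if b then 1ℚ else 0ℚ)) x₀∈U) (solve 1 (λ a → a :- a :* con 1ℚ := con 0ℚ) refl m)
      shrinks : ∀ x → (if support rest x then 1 else 0) ≤ (if U x then 1 else 0)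
      shrinks x = if-mono (λ x∈supp → support-true {g} (λ gx≡0 → support-≢0 {rest} x∈supp (rest-zero gx≡0)))

  module _ (λ₁ : ℚ) (cheeger : ∀ U → Interior U → λ₁ * toℚ (card U) ≤ℚ toℚ (cut U)) where

    coarea : ∀ s (g : Vertex → ℚ) → card (support g) ≤ s → (∀ x → 0ℚ ≤ℚ g x) → (∀ x → Boundary G x → g x ≡ 0ℚ) →
             λ₁ * sumℚ g ≤ℚ edgeVariation G g
    coarea-cases : ∀ s (g : Vertex → ℚ) → card (support g) ≤ s → (∀ x → 0ℚ ≤ℚ g x) → (∀ x → Boundary G x → g x ≡ 0ℚ) →
                   (∀ x → g x ≡ 0ℚ) ⊎ (∃ λ x → g x ≢ 0ℚ) → λ₁ * sumℚ g ≤ℚ edgeVariation G g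

    coarea s g supp≤s g≥0 g-boundary = coarea-cases s g supp≤s g≥0 g-boundary (zero-or-nonzero g)

    coarea-cases _ g _ _ _ (inj₁ g≡0) = subst (_≤ℚ edgeVariation G g) (sym λ₁*sum≡0) (edgeVariation-nonNeg g)
      where
      λ₁*sum≡0 : λ₁ * sumℚ g ≡ 0ℚ
      λ₁*sum≡0 = trans (cong (λ₁ *_) (trans (sumℚ-cong g≡0) (sumℚ-zeros (V G)))) (ℚₚ.*-zeroʳ λ₁)
    coarea-cases zero g supp≤0 _ _ (inj₂ (x , gx≢0)) = ⊥-elim (ℕₚ.<⇒≱ (card-pos {support g} (support-true {g} gx≢0)) supp≤0)
    coarea-cases (suc s) g supp≤1+s g≥0 g-boundary (inj₂ nonzero) = begin
      λ₁ * sumℚ g                              ≡⟨ cong (λ₁ *_) sumℚ-peel ⟩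
      λ₁ * (m * toℚ (card U) + sumℚ rest)      ≡⟨ l*[m*c+r]≡m*[l*c]+l*r λ₁ m (toℚ (card U)) (sumℚ rest) ⟩
      m * (λ₁ * toℚ (card U)) + λ₁ * sumℚ rest ≤⟨ ℚₚ.+-mono-≤ (*-monoˡ-≤-nonNeg (g≥0 x₀) (cheeger U (U-interior g-boundary)))
                                                              (coarea s rest rest-support≤s rest-nonNeg (λ x b → rest-zero (g-boundary x b))) ⟩
      m * toℚ (cut U) + edgeVariation G rest   ≡⟨ edgeVariation-peel ⟨
      edgeVariation G g                        ∎
      where
      open ℚₚ.≤-Reasoning
      least : ∃ λ x₀ → g x₀ ≢ 0ℚ × (∀ x → g x ≢ 0ℚ → g x₀ ≤ℚ g x)
      least = FiniteMinimum.minimum (allFin (V G)) ∈-allFin (λ x → ¬? (g x ℚₚ.≟ 0ℚ)) g nonzero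
      x₀ : Vertex
      x₀ = proj₁ least
      open BottomLayer g g≥0 x₀ (proj₁ (proj₂ least)) (proj₂ (proj₂ least))
      rest-support≤s : card (support rest) ≤ s
      rest-support≤s = ℕₚ.≤-pred (ℕₚ.<-≤-trans support-shrinks supp≤1+s)

    rayleigh-bound : ∀ f → Admissible G f → λ₁ * mass G f ≤ℚ edgeVariation G f
    rayleigh-bound f (_ , f-boundary) =
      ℚₚ.≤-trans (coarea (card (support ∣f∣)) ∣f∣ ℕₚ.≤-refl (λ x → ℚₚ.0≤∣p∣ (f x)) (λ x b → cong ∣_∣ (f-boundary x b)))
                 (sumℚ-mono-≤ (λ x → sumℚ-mono-≤ (pointwise x)))
      where
      ∣f∣ : Vertex → ℚ
      ∣f∣ x = ∣ f x ∣
      pointwise : ∀ x y → (if edge? x y then ∣ ∣f∣ x - ∣f∣ y ∣ else 0ℚ) ≤ℚ (if edge? x y then ∣ f x - f y ∣ else 0ℚ)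
      pointwise x y with edge? x y
      ... | true  = ∣∣p∣-∣q∣∣≤∣p-q∣ (f x) (f y)
      ... | false = ℚₚ.≤-refl

module FirstEigenvalue (G : Graph) (U₀ : Fin (V G) → Bool) (U₀-interior : GraphCounting.Interior G U₀)
                       (U₀-nonempty : 0 < GraphCounting.card G U₀) where
  open import Data.Rational using (0ℚ; _*_)
  open import Data.Bool.Properties using () renaming (_≟_ to _≟ᵇ_)
  open import Relation.Nullary.Decidable using (_→-dec_)
  open GraphCounting G
  open Rationals
  open Coarea G
  open BoolVectors

  CheegerSet : Vec Bool (V G) → Set
  CheegerSet v = Interior (Vec.lookup v) × 0 < card (Vec.lookup v)

  cheegerSet? : Decidable CheegerSet
  cheegerSet? v = Finₚ.all? (λ x → (Vec.lookup v x ≟ᵇ true) →-dec ¬? (deg G x ℕₚ.≟ 1)) ×-dec (0 ℕₚ.<? card (Vec.lookup v))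

  cheegerRatio : Vec Bool (V G) → ℚ
  cheegerRatio v = toℚ (cut (Vec.lookup v)) * recip (card (Vec.lookup v))

  private
    tabulate-CheegerSet : ∀ {U} → Interior U → 0 < card U → CheegerSet (Vec.tabulate U)
    tabulate-CheegerSet {U} U-interior U-nonempty =
      (λ x in-U → U-interior x (trans (sym (VecP.lookup∘tabulate U x)) in-U)) ,
      subst (0 <_) (sym (card-cong (VecP.lookup∘tabulate U))) U-nonempty

    optimal = FiniteMinimum.minimum (allBoolVecs (V G)) ∈-allBoolVecs cheegerSet? cheegerRatio
                                    (Vec.tabulate U₀ , tabulate-CheegerSet U₀-interior U₀-nonempty)

  U* : Vertex → Bool
  U* = Vec.lookup (proj₁ optimal)

  λ₁ : ℚ
  λ₁ = cheegerRatio (proj₁ optimal)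

  U*-interior : Interior U*
  U*-interior = proj₁ (proj₁ (proj₂ optimal))

  U*-nonempty : 0 < card U*
  U*-nonempty = proj₂ (proj₁ (proj₂ optimal))

  λ₁-attained : λ₁ * toℚ (card U*) ≡ toℚ (cut U*)
  λ₁-attained = cancel (card U*) U*-nonempty
    where
    cancel : ∀ c → 0 < c → toℚ (cut U*) * recip c * toℚ c ≡ toℚ (cut U*)
    cancel (suc k) _ = *-recip-cancelʳ (toℚ (cut U*)) k

  cheeger : ∀ U → Interior U → λ₁ * toℚ (card U) ≤ℚ toℚ (cut U)
  cheeger U U-interior = bound (card U) refl
    where
    lookup-tabulate = VecP.lookup∘tabulate U
    bound : ∀ c → card U ≡ c → λ₁ * toℚ c ≤ℚ toℚ (cut U)
    bound zero    _     = subst (_≤ℚ toℚ (cut U)) (sym (ℚₚ.*-zeroʳ λ₁)) (toℚ-nonNeg (cut U))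
    bound (suc k) card≡ = begin
      λ₁ * toℚ (suc k)                          ≤⟨ *-monoʳ-≤-nonNeg (toℚ-nonNeg (suc k)) λ₁≤ratio ⟩
      toℚ (cut U) * recip (suc k) * toℚ (suc k) ≡⟨ *-recip-cancelʳ (toℚ (cut U)) k ⟩
      toℚ (cut U)                               ∎
      where
      open ℚₚ.≤-Reasoning
      λ₁≤ratio : λ₁ ≤ℚ toℚ (cut U) * recip (suc k)
      λ₁≤ratio = subst (λ₁ ≤ℚ_) (cong₂ (λ a c → toℚ a * recip c) (cut-cong lookup-tabulate) (trans (card-cong lookup-tabulate) card≡))
                       (proj₂ (proj₂ optimal) (Vec.tabulate U) (tabulate-CheegerSet U-interior (subst (0 <_) (sym card≡) (s≤s z≤n))))

  isLambda11 : IsLambda11 G λ₁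
  isLambda11 = (χ U* , (nonzero , vanishes) , attained) , rayleigh-bound λ₁ cheeger
    where
    nonzero : ∃ λ x → χ U* x ≢ 0ℚ
    nonzero = proj₁ (member U*-nonempty) , χ-nonzero {U*} (proj₂ (member U*-nonempty))
    vanishes : ∀ x → Boundary G x → χ U* x ≡ 0ℚ
    vanishes x x-pendant = χ-zero {U*} (interior-∌-boundary U*-interior x-pendant)
    attained : edgeVariation G (χ U*) ≡ λ₁ * mass G (χ U*)
    attained = trans (edgeVariation-χ U*) (trans (sym λ₁-attained) (cong (λ₁ *_) (sym (mass-χ U*))))

module PendantEigenvalue (n : ℕ) (4≤n : 4 ≤ n) (G : Graph) (conn : Connected G) (edges : edgeCount G ≡ n)
                         (b : Fin (V G)) (b-pendant : Boundary G b) where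
  open import Data.Rational using (0ℚ; _*_)
  open GraphCounting G
  open Rationals
  open Arithmetic
  open PendantGraph n G conn edges b b-pendant

  N : ℕ
  N = n ∸ 1

  1+N≡n : suc N ≡ n
  1+N≡n = suc[n∸1]≡n (ℕₚ.≤-trans (s≤s z≤n) 4≤n)

  3≤N : 3 ≤ N
  3≤N = ℕₚ.∸-monoˡ-≤ 1 4≤n

  open FirstEigenvalue G Ω Ω-interior (Ω-nonempty (ℕₚ.≤-trans (s≤s (s≤s z≤n)) 4≤n)) public using (λ₁; isLambda11)
  open FirstEigenvalue G Ω Ω-interior (Ω-nonempty (ℕₚ.≤-trans (s≤s (s≤s z≤n)) 4≤n))
    using (U*; U*-interior; U*-nonempty; λ₁-attained; cheeger)

  λ₁-nonNeg : 0ℚ ≤ℚ λ₁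
  λ₁-nonNeg = subst (_≤ℚ λ₁) (ℚₚ.*-zeroʳ (toℚ (cut U*))) (*-monoˡ-≤-nonNeg (toℚ-nonNeg (cut U*)) (recip-nonNeg (card U*)))

  card*≤N : card U* ≤ N
  card*≤N = ℕₚ.<⇒≤pred (card-< U*-interior)

  lower-bound : 1ℚ ≤ℚ λ₁ * toℚ N
  lower-bound = begin
    1ℚ                   ≤⟨ toℚ-mono-≤ (cut-≥-1 U*-interior U*-nonempty) ⟩
    toℚ (cut U*)         ≡⟨ λ₁-attained ⟨
    λ₁ * toℚ (card U*)   ≤⟨ *-monoˡ-≤-nonNeg λ₁-nonNeg (toℚ-mono-≤ card*≤N) ⟩
    λ₁ * toℚ N           ∎
    where open ℚₚ.≤-Reasoning

  module _ (tight : λ₁ * toℚ N ≡ 1ℚ) where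

    cut*N≡card* : cut U* ℕ.* N ≡ card U*
    cut*N≡card* = toℚ-injective (begin
      toℚ (cut U* ℕ.* N)           ≡⟨ toℚ-* (cut U*) N ⟩
      toℚ (cut U*) * toℚ N         ≡⟨ cong (_* toℚ N) λ₁-attained ⟨
      λ₁ * toℚ (card U*) * toℚ N   ≡⟨ cong (_* toℚ N) (ℚₚ.*-comm λ₁ (toℚ (card U*))) ⟩
      toℚ (card U*) * λ₁ * toℚ N   ≡⟨ ℚₚ.*-assoc (toℚ (card U*)) λ₁ (toℚ N) ⟩
      toℚ (card U*) * (λ₁ * toℚ N) ≡⟨ cong (toℚ (card U*) *_) tight ⟩
      toℚ (card U*) * 1ℚ           ≡⟨ ℚₚ.*-identityʳ _ ⟩
      toℚ (card U*)                ∎)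
      where open ≡-Reasoning

    -- 1 ≤ cut U* and card U* ≤ N leave no room in cut U* · N = card U*.
    cut*≡1 : cut U* ≡ 1
    cut*≡1 = ℕₚ.≤-antisym (m*n≡o≤n⇒m≤1 (ℕₚ.≤-trans (s≤s z≤n) 3≤N) cut*N≡card* card*≤N) (cut-≥-1 U*-interior U*-nonempty)

    1+card*≡n : suc (card U*) ≡ n
    1+card*≡n = trans (cong suc (trans (sym cut*N≡card*) (trans (cong (ℕ._* N) cut*≡1) (ℕₚ.*-identityˡ N)))) 1+N≡n

    equality⇒tadpole : ∃ λ i → 3 ≤ i × i < n × IsoTadpole G n i
    equality⇒tadpole = subst (λ m → ∃ λ i → 3 ≤ i × i < m × IsoTadpole G m i) 1+N≡n
      (TadpoleRecognition.recognised G conn b b-pendant N (trans V≡n (sym 1+N≡n)) 3≤N deg-2-or-3 deg-≥3-unique)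
      where open Extremal U*-interior cut*≡1 1+card*≡n

  tadpole⇒equality : (∃ λ i → 3 ≤ i × i < n × IsoTadpole G n i) → λ₁ * toℚ N ≡ 1ℚ
  tadpole⇒equality (i , 3≤i , i<n , σ , σ-adj) = ℚₚ.≤-antisym (begin
    λ₁ * toℚ N                ≡⟨ cong (λ c → λ₁ * toℚ c) card-not-last ⟨
    λ₁ * toℚ (card not-last)  ≤⟨ cheeger not-last not-last-interior ⟩
    toℚ (cut not-last)        ≤⟨ toℚ-mono-≤ cut-not-last-≤-1 ⟩
    1ℚ                        ∎) lower-bound
    where
    open ℚₚ.≤-Reasoning
    open FromTadpole 3≤i i<n σ σ-adj

open import Data.Integer using (+_)
open import Data.Rational using (_*_)

theorem1p4 : (n : ℕ) → 4 ≤ n → (G : Graph) → Connected G → edgeCount G ≡ n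
    → (∃ λ x → Boundary G x)
    → Σ ℚ λ λ₁ → IsLambda11 G λ₁
        × 1ℚ ≤ℚ λ₁ * ((+ (n ∸ 1)) / 1)
        × ((λ₁ * ((+ (n ∸ 1)) / 1) ≡ 1ℚ) ⇔ (∃ λ i → 3 ≤ i × i < n × IsoTadpole G n i))
theorem1p4 n 4≤n G conn edges (b , b-pendant) =
  λ₁ , isLambda11 , lower-bound , mk⇔ equality⇒tadpole tadpole⇒equality
  where open PendantEigenvalue n 4≤n G conn edges b b-pendant
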